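{- Let $\mathbf c=(c_1,\ldots,c_n)$ and $\mathbf a=(a_1,\ldots,a_n,-\sum_i a_i)$ with $a_i,c_i\in\mathbb{Z}_{\ge0}$. Then \[ \mathrm{vol}\,\mathcal{F}_{\Pi_n(\mathbf c)}(\mathbf a)=\sum_{\mathbf j}\binom{c_1+\cdots+c_n}{j_1,\ldots,j_n}a_1^{j_1}\cdots a_n^{j_n}, \] \[ K_{\Pi_n(\mathbf c)}(\mathbf a)=\sum_{\mathbf j}\binom{a_1+c_1}{j_1}\cdots\binom{a_n+c_n}{j_n}=\sum_{\mathbf j}\left(\!\!\binom{a_1+1}{j_1}\!\!\right)\left(\!\!\binom{a_2}{j_2}\!\!\right)\cdots\left(\!\!\binom{a_n}{j_n}\!\!\right), \] where each sum is over weak compositions $\mathbf j=(j_1,\ldots,j_n)$ of $\sum_i c_i$ with $\mathbf j\ge(c_1,\ldots,c_n)$ in dominance order.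
   Context: $\Pi_n(\mathbf c)$ is the multigraph on $[n+1]$ consisting of the path $1\to2\to\cdots\to n+1$ (edges $(i,i+1)$, $i=1,\ldots,n$) together with $c_i$ copies of the edge $(i,n+1)$ for each $i\in[n]$. $\mathcal{F}_G(\mathbf a)$ is the set of nonnegative real edge flows with (outflow minus inflow) at vertex $i$ equal to $a_i$ for $i\in[n]$; $K_G(\mathbf a)$ is its number of integer points; $\mathrm{vol}$ is normalized volume ($d!$ times the volume relative to the lattice of integer points of the affine span, $d=\sum_i c_i$). $\left(\!\binom{p}{k}\!\right)=\binom{p+k-1}{k}$, with binomial coefficients $\binom{x}{k}=x(x-1)\cdots(x-k+1)/k!$. Dominance: $\mathbf j\ge\mathbf c$ iff $j_1+\cdots+j_k\ge c_1+\cdots+c_k$ for all $k$. -}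

module Defs where

open import Data.Nat using (ℕ; zero; suc; _+_; _*_; _∸_; _^_; _≤_; _≤?_; _≡ᵇ_; _!)
open import Data.Nat.Combinatorics using (_C_)
open import Data.Integer as ℤ using (ℤ; +_)
open import Data.Rational as ℚ using (ℚ; _<_; ∣_∣)
open import Data.Bool using (if_then_else_)
open import Data.Fin using (Fin; toℕ)
open import Data.List as List using (List; []; _∷_; [_]; map; concatMap; upTo; take; filter; allFin; replicate; concat; length; _++_)
open import Data.Nat.ListAction using (sum)
open import Data.List.Relation.Unary.All using (All; all?)
open import Data.Vec as Vec using (Vec; toList; lookup)
open import Data.Product using (Σ; _×_; _,_; ∃)
open import Function.Bundles using (_↔_)
open import Relation.Nullary using (Dec)
open import Relation.Binary.PropositionalEquality using (_≡_)

-- Multigraphs on vertices 1,2,...: a list of directed edges (tail , head).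
-- Repeated entries are parallel copies of an edge.

Edge : Set
Edge = ℕ × ℕ

Graph : Set
Graph = List Edge

Flow : Graph → Set
Flow G = Vec ℕ (length G)

outflow : (G : Graph) → Flow G → ℕ → ℕ
outflow [] Vec.[] v = 0
outflow ((s , t) ∷ G) (x Vec.∷ f) v = (if s ≡ᵇ v then x else 0) + outflow G f v

inflow : (G : Graph) → Flow G → ℕ → ℕ
inflow [] Vec.[] v = 0
inflow ((s , t) ∷ G) (x Vec.∷ f) v = (if t ≡ᵇ v then x else 0) + inflow G f v

IsFlow : (G : Graph) {n : ℕ} → Vec ℕ n → Flow G → Set
IsFlow G {n} a f =
  All (λ (i : Fin n) →
         (+ outflow G f (suc (toℕ i))) ℤ.- (+ inflow G f (suc (toℕ i))) ≡ + lookup a i)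
      (allFin n)

IntFlows : (G : Graph) {n : ℕ} → Vec ℕ n → Set
IntFlows G a = Σ (Flow G) (IsFlow G a)

HasCount : (G : Graph) {n : ℕ} → Vec ℕ n → ℕ → Set
HasCount G a N = Fin N ↔ IntFlows G a

Pi : (n : ℕ) → Vec ℕ n → Graph
Pi n c =
  map (λ i → (suc i , suc (suc i))) (upTo n)
  ++ concat (map (λ (i : Fin n) → replicate (lookup c i) (suc (toℕ i) , suc n)) (allFin n))

-- Normalized volume (Jordan content relative to the lattice of integer
-- points of the affine span, times d!), defined by lattice-point counting:
-- vol F_G(a) = V iff  d! · #(F_G(a) ∩ (1/t)ℤ^E) / t^d → V  as t → ∞.
-- Since a is integral, F_G(a) ∩ (1/t)ℤ^E is in bijection with the
-- integer points of F_G(t·a).  We write the quotient multiplied out.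

fromℕ : ℕ → ℚ
fromℕ n = (+ n) ℚ./ 1

IsNormalizedVolume : (G : Graph) {n : ℕ} → Vec ℕ n → (d : ℕ) → ℚ → Set
IsNormalizedVolume G a d V =
  (ε : ℚ) → ℚ.0ℚ < ε →
  ∃ λ (T : ℕ) → (t : ℕ) → T ≤ t → (N : ℕ) → HasCount G (Vec.map (suc t *_) a) N →
    ∣ fromℕ (N * d !) ℚ.- V ℚ.* fromℕ (suc t ^ d) ∣ < ε ℚ.* fromℕ (suc t ^ d)

weakComps : (n d : ℕ) → List (Vec ℕ n)
weakComps zero zero = [ Vec.[] ]
weakComps zero (suc d) = []
weakComps (suc n) d =
  concatMap (λ k → map (k Vec.∷_) (weakComps n (d ∸ k))) (upTo (suc d))

Dominates : {n : ℕ} → Vec ℕ n → Vec ℕ n → Set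
Dominates {n} j c =
  All (λ k → sum (take k (toList c)) ≤ sum (take k (toList j))) (upTo (suc n))

dominates? : {n : ℕ} (c j : Vec ℕ n) → Dec (Dominates j c)
dominates? {n} c j = all? (λ k → sum (take k (toList c)) ≤? sum (take k (toList j))) (upTo (suc n))

sumDom : {n : ℕ} → Vec ℕ n → (Vec ℕ n → ℕ) → ℕ
sumDom {n} c F = sum (map F (filter (dominates? c) (weakComps n (Vec.sum c))))

multinomial : List ℕ → ℕ
multinomial [] = 1
multinomial (x ∷ xs) = ((x + sum xs) C x) * multinomial xs

multichoose : ℕ → ℕ → ℕ
multichoose p k = (p + k ∸ 1) C k

volRHS : {n : ℕ} → Vec ℕ n → Vec ℕ n → ℕ
volRHS a c = sumDom c (λ j → multinomial (toList j) * Vec.foldr _ _*_ 1 (Vec.zipWith _^_ a j))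

countRHS₁ : {n : ℕ} → Vec ℕ n → Vec ℕ n → ℕ
countRHS₁ a c = sumDom c (λ j → Vec.foldr _ _*_ 1 (Vec.zipWith _C_ (Vec.zipWith _+_ a c) j))

countRHS₂ : {n : ℕ} → Vec ℕ (suc n) → Vec ℕ (suc n) → ℕ
countRHS₂ (a₁ Vec.∷ a) c =
  sumDom c (λ { (j₁ Vec.∷ j) → multichoose (a₁ + 1) j₁ * Vec.foldr _ _*_ 1 (Vec.zipWith multichoose a j) })

-- A flow on Π_n(c) is determined by the flows xᵢ on the path edges (i, i+1) and the vectors
-- yᵢ ∈ ℕ^cᵢ of flows on the copies of (i, n+1), subject to Σ yᵢ + xᵢ = x_{i-1} + aᵢ with x₀ = 0.
-- Choosing these level by level writes K(a) as an iterated sum.  Summing each level with the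
-- hockey-stick identity and expanding with Vandermonde's convolution (for binomial, respectively
-- multiset, coefficients) turns it into a sum over weak compositions j of Σ c in which the
-- surplus of the partial sums of j over those of c never becomes negative, i.e. j ≥ c.
-- The volume is the leading coefficient of t ↦ K(t a): each term ∏ binom(t aᵢ + cᵢ, jᵢ) equals
-- ∏ (aᵢ t)^jᵢ / jᵢ! up to O(t^(d-1)), so d! K(t a) / t^d tends to Σ multinomial(j) aʲ.

module Submission where

open import Axiom.UniquenessOfIdentityProofs using (module Decidable⇒UIP)
open import Data.Bool using (Bool; true; false; if_then_else_; _∧_)
open import Data.Bool.Properties using (T-≡; ¬-not)
open import Data.Fin using (Fin; zero; suc; toℕ)
open import Data.Fin.Permutation using (↔⇒≡)
open import Data.Fin.Properties using (+↔⊎; toℕ<n)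
open import Data.Integer as ℤ using (+[1+_]; -[1+_])
import Data.Integer.Properties as ℤ
import Data.Integer.Tactic.RingSolver as ℤ-Solver
open import Data.List
  using (List; []; _∷_; _++_; map; applyUpTo; upTo; concatMap; filter; take; replicate; concat; tabulate; length)
open import Data.List.Properties using (map-∘; map-upTo; map-++; map-cong; map-tabulate; tabulate-cong; length-replicate)
open import Data.List.Relation.Unary.All as All using (All; []; _∷_)
open import Data.List.Relation.Unary.All.Properties
  using (applyUpTo⁺₁; applyUpTo⁻; tabulate⁺; tabulate⁻; concat⁺; map⁺; filter⁺)
open import Data.Nat
open import Data.Nat.Combinatorics
  using (_C_; _P_; nCk+nC[k+1]≡[n+1]C[k+1]; k>n⇒nCk≡0; nCk≡nPk/k!; nCk≡n!/k![n-k]!; k![n∸k]!∣n!)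
open import Data.Nat.Combinatorics.Base using (_P′_)
open import Data.Nat.Combinatorics.Specification using (k!∣nP′k)
open import Data.Nat.Coprimality using (Coprime)
import Data.Nat.Coprimality as Coprime
open import Data.Nat.DivMod using (_/_; m/n*n≡m)
open import Data.Nat.ListAction using () renaming (sum to listSum)
open import Data.Nat.ListAction.Properties using () renaming (sum-++ to listSum-++)
open import Data.Nat.Properties
open import Algebra.Properties.CommutativeSemigroup +-commutativeSemigroup using (interchange)
open import Data.Nat.Tactic.RingSolver using (solve-∀)
open import Data.Product using (Σ; Σ-syntax; _×_; _,_; uncurry)
open import Data.Product.Function.Dependent.Propositional using (Σ-↔)
open import Data.Product.Function.NonDependent.Propositional using (_×-↔_)
open import Data.Rational as ℚ using (mkℚ; toℚᵘ)
import Data.Rational.Properties as ℚ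
open import Data.Rational.Unnormalised as ℚᵘ using (mkℚᵘ; _≃_)
import Data.Rational.Unnormalised.Properties as ℚᵘ
open import Data.Sum using (_⊎_; inj₁; inj₂)
open import Data.Sum.Function.Propositional using (_⊎-↔_)
open import Data.Unit using (⊤; tt)
open import Data.Vec as Vec using (Vec; []; _∷_; sum; toList; lookup)
open import Data.Vec.Properties using (cast-sym)
open import Function using (_∘_; id)
open import Function.Bundles using (_↔_; mk↔ₛ′; Equivalence; Inverse)
open import Function.Properties.Inverse using (↔-refl; ↔-trans; ↔-sym)
open import Level using (0ℓ)
open import Relation.Binary.PropositionalEquality
open import Relation.Nullary using (Irrelevant; does; contradiction; yes; no)
open import Relation.Nullary.Decidable using (dec-true; dec-false)
open import Relation.Unary using (Pred; Decidable)
open import Defs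

-- Finite sums

∑< : ℕ → (ℕ → ℕ) → ℕ
∑< n f = listSum (applyUpTo f n)

syntax ∑< n (λ i → e) = ∑[ i < n ] e

guard : Bool → ℕ → ℕ
guard b y = if b then y else 0

≤ᵇ-suc : ∀ m n → (suc m ≤ᵇ suc n) ≡ (m ≤ᵇ n)
≤ᵇ-suc zero    n = refl
≤ᵇ-suc (suc m) n = refl

≤⇒≤ᵇ≡true : ∀ {m n} → m ≤ n → (m ≤ᵇ n) ≡ true
≤⇒≤ᵇ≡true m≤n = Equivalence.to T-≡ (≤⇒≤ᵇ m≤n)

≤ᵇ≡true⇒≤ : ∀ m n → (m ≤ᵇ n) ≡ true → m ≤ n
≤ᵇ≡true⇒≤ m n eq = ≤ᵇ⇒≤ m n (Equivalence.from T-≡ eq)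

guard-*ˡ : ∀ b k y → k * guard b y ≡ guard b (k * y)
guard-*ˡ true  k y = refl
guard-*ˡ false k y = *-zeroʳ k

guard-comm : ∀ b b′ y → guard b (guard b′ y) ≡ guard b′ (guard b y)
guard-comm true  b′ y = refl
guard-comm false true  y = refl
guard-comm false false y = refl

guard-∧ : ∀ b b′ y → guard (b ∧ b′) y ≡ guard b (guard b′ y)
guard-∧ true  b′ y = refl
guard-∧ false b′ y = refl

∑-cong-< : ∀ n {f g : ℕ → ℕ} → (∀ i → i < n → f i ≡ g i) → ∑< n f ≡ ∑< n g
∑-cong-< zero    eq = refl
∑-cong-< (suc n) eq = cong₂ _+_ (eq 0 z<s) (∑-cong-< n (λ i i<n → eq (suc i) (s<s i<n)))

∑-cong : ∀ n {f g : ℕ → ℕ} → (∀ i → f i ≡ g i) → ∑< n f ≡ ∑< n g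
∑-cong n eq = ∑-cong-< n (λ i _ → eq i)

∑-zero : ∀ n → ∑[ i < n ] 0 ≡ 0
∑-zero zero    = refl
∑-zero (suc n) = ∑-zero n

∑-last : ∀ n (f : ℕ → ℕ) → ∑< (suc n) f ≡ ∑< n f + f n
∑-last zero    f = +-comm (f 0) 0
∑-last (suc n) f = trans (cong (f 0 +_) (∑-last n (f ∘ suc))) (sym (+-assoc (f 0) _ _))

∑-distrib-+ : ∀ n (f g : ℕ → ℕ) → ∑[ i < n ] (f i + g i) ≡ ∑< n f + ∑< n g
∑-distrib-+ zero    f g = refl
∑-distrib-+ (suc n) f g =
  trans (cong (f 0 + g 0 +_) (∑-distrib-+ n (f ∘ suc) (g ∘ suc))) (interchange (f 0) (g 0) _ _)

*-distribˡ-∑ : ∀ n k (f : ℕ → ℕ) → k * ∑< n f ≡ ∑[ i < n ] (k * f i)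
*-distribˡ-∑ zero    k f = *-zeroʳ k
*-distribˡ-∑ (suc n) k f = trans (*-distribˡ-+ k (f 0) _) (cong (k * f 0 +_) (*-distribˡ-∑ n k (f ∘ suc)))

*-distribʳ-∑ : ∀ n k (f : ℕ → ℕ) → ∑< n f * k ≡ ∑[ i < n ] (f i * k)
*-distribʳ-∑ n k f = trans (*-comm _ k) (trans (*-distribˡ-∑ n k f) (∑-cong n (λ i → *-comm k (f i))))

∑-comm : ∀ m n (f : ℕ → ℕ → ℕ) → ∑[ i < m ] ∑[ j < n ] f i j ≡ ∑[ j < n ] ∑[ i < m ] f i j
∑-comm zero    n f = sym (∑-zero n)
∑-comm (suc m) n f = trans (cong (∑< n (f 0) +_) (∑-comm m n (f ∘ suc)))
                           (sym (∑-distrib-+ n (f 0) (λ j → ∑[ i < m ] f (suc i) j)))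

∑-truncate : ∀ n m (f : ℕ → ℕ) → m < n → ∑[ i < n ] guard (i ≤ᵇ m) (f i) ≡ ∑< (suc m) f
∑-truncate (suc n) zero    f _ = cong (f 0 +_) (∑-zero n)
∑-truncate (suc n) (suc m) f (s<s m<n) = cong (f 0 +_) (begin
  ∑[ i < n ] guard (suc i ≤ᵇ suc m) (f (suc i))
    ≡⟨ ∑-cong n (λ i → cong (λ b → guard b (f (suc i))) (≤ᵇ-suc i m)) ⟩
  ∑[ i < n ] guard (i ≤ᵇ m) (f (suc i))         ≡⟨ ∑-truncate n m (f ∘ suc) m<n ⟩
  ∑< (suc m) (f ∘ suc)                          ∎)
  where open ≡-Reasoning

∑-shift : ∀ e n (g : ℕ → ℕ) → ∑[ m < e + n ] guard (e ≤ᵇ m) (g m) ≡ ∑[ k < n ] g (e + k)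
∑-shift zero    n g = refl
∑-shift (suc e) n g = begin
  ∑[ m < e + n ] guard (suc e ≤ᵇ suc m) (g (suc m))
    ≡⟨ ∑-cong (e + n) (λ m → cong (λ b → guard b (g (suc m))) (≤ᵇ-suc e m)) ⟩
  ∑[ m < e + n ] guard (e ≤ᵇ m) (g (suc m))         ≡⟨ ∑-shift e n (g ∘ suc) ⟩
  ∑[ k < n ] g (suc e + k)                          ∎
  where open ≡-Reasoning

∑∈ : {A : Set} → List A → (A → ℕ) → ℕ
∑∈ L f = listSum (map f L)

syntax ∑∈ L (λ x → e) = ∑[ x ∈ L ] e

∑∈-cong-All : {A : Set} {f g : A → ℕ} {L : List A} → All (λ x → f x ≡ g x) L → ∑∈ L f ≡ ∑∈ L g
∑∈-cong-All []         = refl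
∑∈-cong-All (eq ∷ eqs) = cong₂ _+_ eq (∑∈-cong-All eqs)

∑∈-cong : {A : Set} {f g : A → ℕ} (L : List A) → (∀ x → f x ≡ g x) → ∑∈ L f ≡ ∑∈ L g
∑∈-cong L eq = ∑∈-cong-All (All.universal eq L)

∑∈-upTo : ∀ n (f : ℕ → ℕ) → ∑∈ (upTo n) f ≡ ∑< n f
∑∈-upTo n f = cong listSum (map-upTo f n)

∑∈-map : {A B : Set} (g : A → B) (h : B → ℕ) (L : List A) → ∑∈ (map g L) h ≡ ∑∈ L (h ∘ g)
∑∈-map g h L = cong listSum (sym (map-∘ L))

∑∈-concatMap : {A B : Set} (g : A → List B) (h : B → ℕ) (L : List A) →
  ∑∈ (concatMap g L) h ≡ ∑[ x ∈ L ] ∑∈ (g x) h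
∑∈-concatMap g h []      = refl
∑∈-concatMap g h (x ∷ L) = begin
  listSum (map h (g x ++ concatMap g L))        ≡⟨ cong listSum (map-++ h (g x) (concatMap g L)) ⟩
  listSum (map h (g x) ++ map h (concatMap g L)) ≡⟨ listSum-++ (map h (g x)) _ ⟩
  ∑∈ (g x) h + ∑∈ (concatMap g L) h             ≡⟨ cong (∑∈ (g x) h +_) (∑∈-concatMap g h L) ⟩
  ∑∈ (g x) h + ∑[ y ∈ L ] ∑∈ (g y) h            ∎
  where open ≡-Reasoning

*-distribˡ-∑∈ : {A : Set} (k : ℕ) (f : A → ℕ) (L : List A) → k * ∑∈ L f ≡ ∑[ x ∈ L ] (k * f x)
*-distribˡ-∑∈ k f []      = *-zeroʳ k
*-distribˡ-∑∈ k f (x ∷ L) = trans (*-distribˡ-+ k (f x) _) (cong (k * f x +_) (*-distribˡ-∑∈ k f L))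

*-distribʳ-∑∈ : {A : Set} (k : ℕ) (f : A → ℕ) (L : List A) → ∑∈ L f * k ≡ ∑[ x ∈ L ] (f x * k)
*-distribʳ-∑∈ k f L =
  trans (*-comm _ k) (trans (*-distribˡ-∑∈ k f L) (∑∈-cong L (λ x → *-comm k (f x))))

∑∈-guard : {A : Set} (b : Bool) (f : A → ℕ) (L : List A) → ∑[ x ∈ L ] guard b (f x) ≡ guard b (∑∈ L f)
∑∈-guard true  f L = refl
∑∈-guard false f L = trans (∑∈-cong L (λ _ → refl)) (∑∈-zero L)
  where
  ∑∈-zero : {A : Set} (L : List A) → ∑[ x ∈ L ] 0 ≡ 0
  ∑∈-zero []      = refl
  ∑∈-zero (_ ∷ L) = ∑∈-zero L

∑∈-filter : {A : Set} {P : Pred A 0ℓ} (P? : Decidable P) (f : A → ℕ) (L : List A) →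
  ∑∈ (filter P? L) f ≡ ∑[ x ∈ L ] guard (does (P? x)) (f x)
∑∈-filter P? f []      = refl
∑∈-filter P? f (x ∷ L) with does (P? x)
... | true  = cong (f x +_) (∑∈-filter P? f L)
... | false = ∑∈-filter P? f L

-- Binomial identities

pascal : ∀ n k → suc n C suc k ≡ n C k + n C suc k
pascal n k = sym (nCk+nC[k+1]≡[n+1]C[k+1] n k)

hockey-stick : ∀ A c m → c ≤ m → ∑[ x < suc A ] ((x + c) C m) ≡ (suc A + c) C suc m
hockey-stick zero    c m c≤m =
  trans (cong (c C m +_) (sym (k>n⇒nCk≡0 (s≤s c≤m)))) (sym (pascal c m))
hockey-stick (suc A) c m c≤m = begin
  ∑[ x < suc (suc A) ] ((x + c) C m)             ≡⟨ ∑-last (suc A) (λ x → (x + c) C m) ⟩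
  ∑[ x < suc A ] ((x + c) C m) + (suc A + c) C m ≡⟨ cong (_+ (suc A + c) C m) (hockey-stick A c m c≤m) ⟩
  (suc A + c) C suc m + (suc A + c) C m          ≡⟨ +-comm _ ((suc A + c) C m) ⟩
  (suc A + c) C m + (suc A + c) C suc m          ≡⟨ sym (pascal (suc A + c) m) ⟩
  (suc (suc A) + c) C suc m                      ∎
  where open ≡-Reasoning

vandermonde : ∀ A B m → ∑[ r < suc m ] ((A C r) * (B C (m ∸ r))) ≡ (A + B) C m
vandermonde zero    B zero    = +-identityʳ _
vandermonde (suc A) B zero    = refl
vandermonde zero    B (suc m) = begin
  1 * (B C suc m) + ∑[ r < suc m ] ((0 C suc r) * (B C (m ∸ r)))
    ≡⟨ cong₂ _+_ (*-identityˡ _)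
                 (∑-cong (suc m) λ r → cong (_* (B C (m ∸ r))) (k>n⇒nCk≡0 {0} {suc r} z<s)) ⟩
  B C suc m + ∑[ r < suc m ] 0 ≡⟨ cong (B C suc m +_) (∑-zero (suc m)) ⟩
  B C suc m + 0                ≡⟨ +-identityʳ _ ⟩
  B C suc m                    ∎
  where open ≡-Reasoning
vandermonde (suc A) B (suc m) = begin
  1 * b′ 0 + ∑[ r < suc m ] ((suc A C suc r) * b r)
    ≡⟨ cong (1 * b′ 0 +_) (∑-cong (suc m) λ r →
         trans (cong (_* b r) (pascal A r)) (*-distribʳ-+ (b r) (A C r) _)) ⟩
  1 * b′ 0 + ∑[ r < suc m ] ((A C r) * b r + (A C suc r) * b r)
    ≡⟨ cong (1 * b′ 0 +_) (∑-distrib-+ (suc m) (λ r → (A C r) * b r) (λ r → (A C suc r) * b r)) ⟩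
  1 * b′ 0 + (∑[ r < suc m ] ((A C r) * b r) + ∑[ r < suc m ] ((A C suc r) * b r))
    ≡⟨ regroup (1 * b′ 0) _ _ ⟩
  ∑[ r < suc (suc m) ] ((A C r) * b′ r) + ∑[ r < suc m ] ((A C r) * b r)
    ≡⟨ cong₂ _+_ (vandermonde A B (suc m)) (vandermonde A B m) ⟩
  (A + B) C suc m + (A + B) C m ≡⟨ +-comm ((A + B) C suc m) _ ⟩
  (A + B) C m + (A + B) C suc m ≡⟨ pascal (A + B) m ⟨
  suc (A + B) C suc m           ∎
  where
  open ≡-Reasoning
  b b′ : ℕ → ℕ
  b  r = B C (m ∸ r)
  b′ r = B C (suc m ∸ r)
  regroup : ∀ x y z → x + (y + z) ≡ x + z + y
  regroup x y z = trans (cong (x +_) (+-comm y z)) (sym (+-assoc x z y))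

multichoose-pascal : ∀ p k → multichoose (suc p) (suc k) ≡ multichoose p (suc k) + multichoose (suc p) k
multichoose-pascal p k = begin
  (p + suc k) C suc k               ≡⟨ cong (_C suc k) (+-suc p k) ⟩
  suc (p + k) C suc k               ≡⟨ pascal (p + k) k ⟩
  (p + k) C k + (p + k) C suc k     ≡⟨ +-comm ((p + k) C k) _ ⟩
  (p + k) C suc k + (p + k) C k     ≡⟨ cong (λ n → (n ∸ 1) C suc k + (p + k) C k) (sym (+-suc p k)) ⟩
  multichoose p (suc k) + multichoose (suc p) k ∎
  where open ≡-Reasoning

vandermonde-multichoose : ∀ p q m →
  ∑[ r < suc m ] (multichoose p r * multichoose q (m ∸ r)) ≡ multichoose (p + q) m
vandermonde-multichoose zero    q zero    = +-identityʳ _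
vandermonde-multichoose (suc p) q zero    = refl
vandermonde-multichoose zero    q (suc m) = begin
  1 * multichoose q (suc m) + ∑[ r < suc m ] (multichoose 0 (suc r) * multichoose q (m ∸ r))
    ≡⟨ cong₂ _+_ (*-identityˡ _)
                 (∑-cong (suc m) λ r → cong (_* multichoose q (m ∸ r)) (k>n⇒nCk≡0 (n<1+n r))) ⟩
  multichoose q (suc m) + ∑[ r < suc m ] 0 ≡⟨ cong (multichoose q (suc m) +_) (∑-zero (suc m)) ⟩
  multichoose q (suc m) + 0                ≡⟨ +-identityʳ _ ⟩
  multichoose q (suc m)                    ∎
  where open ≡-Reasoning
vandermonde-multichoose (suc p) q (suc m) = begin
  1 * M q (suc m) + ∑[ r < suc m ] (M (suc p) (suc r) * u r)
    ≡⟨ cong (1 * M q (suc m) +_) (∑-cong (suc m) λ r →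
         trans (cong (_* u r) (multichoose-pascal p r)) (*-distribʳ-+ (u r) (M p (suc r)) _)) ⟩
  1 * M q (suc m) + ∑[ r < suc m ] (M p (suc r) * u r + M (suc p) r * u r)
    ≡⟨ cong (1 * M q (suc m) +_) (∑-distrib-+ (suc m) (λ r → M p (suc r) * u r) (λ r → M (suc p) r * u r)) ⟩
  1 * M q (suc m) + (∑[ r < suc m ] (M p (suc r) * u r) + ∑[ r < suc m ] (M (suc p) r * u r))
    ≡⟨ +-assoc (1 * M q (suc m)) _ _ ⟨
  ∑[ r < suc (suc m) ] (M p r * M q (suc m ∸ r)) + ∑[ r < suc m ] (M (suc p) r * u r)
    ≡⟨ cong₂ _+_ (vandermonde-multichoose p q (suc m)) (vandermonde-multichoose (suc p) q m) ⟩
  M (p + q) (suc m) + M (suc p + q) m ≡⟨ multichoose-pascal (p + q) m ⟨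
  M (suc p + q) (suc m)               ∎
  where
  open ≡-Reasoning
  M = multichoose
  u : ℕ → ℕ
  u r = M q (m ∸ r)

-- Dominance and surplus sums

weightProduct : ∀ {n} → Vec (ℕ → ℕ) n → Vec ℕ n → ℕ
weightProduct []       []       = 1
weightProduct (w ∷ ws) (j ∷ js) = w j * weightProduct ws js

-- e is the surplus of the partial sums of j over those of c accumulated so far.
dominatesFrom : ∀ {n} → ℕ → Vec ℕ n → Vec ℕ n → Bool
dominatesFrom e []       []       = true
dominatesFrom e (c ∷ cs) (k ∷ js) = (c ≤ᵇ e + k) ∧ dominatesFrom (e + k ∸ c) cs js

prefixSum : ∀ {n} → ℕ → Vec ℕ n → ℕ
prefixSum m v = listSum (take m (toList v))

dominatesFrom-sound : ∀ {n} e (c j : Vec ℕ n) → dominatesFrom e c j ≡ true →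
  ∀ m → m < suc n → prefixSum m c ≤ e + prefixSum m j
dominatesFrom-sound e []       []       _ zero    _         = z≤n
dominatesFrom-sound e []       []       _ (suc m) _         = z≤n
dominatesFrom-sound e (c ∷ cs) (k ∷ js) _ zero    _         = z≤n
dominatesFrom-sound e (c ∷ cs) (k ∷ js) D (suc m) (s<s m<n) with c ≤ᵇ e + k in c≤e+k
... | true = begin
  c + prefixSum m cs                  ≤⟨ +-monoʳ-≤ c (dominatesFrom-sound (e + k ∸ c) cs js D m m<n) ⟩
  c + ((e + k ∸ c) + prefixSum m js)  ≡⟨ sym (+-assoc c _ _) ⟩
  (c + (e + k ∸ c)) + prefixSum m js
    ≡⟨ cong (_+ prefixSum m js) (m+[n∸m]≡n (≤ᵇ≡true⇒≤ c (e + k) c≤e+k)) ⟩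
  (e + k) + prefixSum m js            ≡⟨ +-assoc e k _ ⟩
  e + (k + prefixSum m js)            ∎
  where open ≤-Reasoning

dominatesFrom-complete : ∀ {n} e (c j : Vec ℕ n) →
  (∀ m → m < suc n → prefixSum m c ≤ e + prefixSum m j) → dominatesFrom e c j ≡ true
dominatesFrom-complete e []       []       _ = refl
dominatesFrom-complete e (c ∷ cs) (k ∷ js) D with c ≤ᵇ e + k in c≤ᵇe+k
... | true  = dominatesFrom-complete (e + k ∸ c) cs js D′
  where
  c≤e+k = ≤ᵇ≡true⇒≤ c (e + k) c≤ᵇe+k
  D′ : ∀ m → m < suc _ → prefixSum m cs ≤ (e + k ∸ c) + prefixSum m js
  D′ m m<n = +-cancelˡ-≤ c _ _ (begin
    c + prefixSum m cs                 ≤⟨ D (suc m) (s<s m<n) ⟩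
    e + (k + prefixSum m js)           ≡⟨ sym (+-assoc e k _) ⟩
    (e + k) + prefixSum m js           ≡⟨ cong (_+ prefixSum m js) (sym (m+[n∸m]≡n c≤e+k)) ⟩
    (c + (e + k ∸ c)) + prefixSum m js ≡⟨ +-assoc c _ _ ⟩
    c + ((e + k ∸ c) + prefixSum m js) ∎)
    where open ≤-Reasoning
... | false = contradiction (trans (sym c≤ᵇe+k) (≤⇒≤ᵇ≡true c≤e+k)) λ ()
  where
  c≤e+k : c ≤ e + k
  c≤e+k = begin
    c           ≡⟨ sym (+-identityʳ c) ⟩
    c + 0       ≤⟨ D 1 (s<s z<s) ⟩
    e + (k + 0) ≡⟨ cong (e +_) (+-identityʳ k) ⟩
    e + k       ∎
    where open ≤-Reasoning

does-dominates? : ∀ {n} (c j : Vec ℕ n) → does (dominates? c j) ≡ dominatesFrom 0 c j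
does-dominates? {n} c j with dominatesFrom 0 c j in eq
... | true  = dec-true (dominates? c j) (applyUpTo⁺₁ id (suc n) (λ {m} → dominatesFrom-sound 0 c j eq m))
... | false = dec-false (dominates? c j) (λ D →
  contradiction (trans (sym eq) (dominatesFrom-complete 0 c j (λ m → applyUpTo⁻ id (suc n) D))) λ ())

dominatedSum : ∀ {n} → ℕ → ℕ → Vec (ℕ → ℕ) n → Vec ℕ n → ℕ
dominatedSum {n} e d ws cs = ∑[ j ∈ weakComps n d ] guard (dominatesFrom e cs j) (weightProduct ws j)

dominatedSum-∷ : ∀ {n} e d w (ws : Vec (ℕ → ℕ) n) c cs →
  dominatedSum e d (w ∷ ws) (c ∷ cs)
  ≡ ∑[ k < suc d ] guard (c ≤ᵇ e + k) (w k * dominatedSum (e + k ∸ c) (d ∸ k) ws cs)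
dominatedSum-∷ {n} e d w ws c cs = begin
  ∑∈ (concatMap (λ k → map (k ∷_) (weakComps n (d ∸ k))) (upTo (suc d))) h
    ≡⟨ ∑∈-concatMap (λ k → map (k ∷_) (weakComps n (d ∸ k))) h (upTo (suc d)) ⟩
  ∑[ k ∈ upTo (suc d) ] ∑∈ (map (k ∷_) (weakComps n (d ∸ k))) h
    ≡⟨ ∑∈-upTo (suc d) _ ⟩
  ∑[ k < suc d ] ∑∈ (map (k ∷_) (weakComps n (d ∸ k))) h
    ≡⟨ ∑-cong (suc d) summand ⟩
  ∑[ k < suc d ] guard (c ≤ᵇ e + k) (w k * dominatedSum (e + k ∸ c) (d ∸ k) ws cs) ∎
  where
  open ≡-Reasoning
  h : Vec ℕ (suc n) → ℕ
  h j = guard (dominatesFrom e (c ∷ cs) j) (weightProduct (w ∷ ws) j)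
  summand : ∀ k → ∑∈ (map (k ∷_) (weakComps n (d ∸ k))) h
                   ≡ guard (c ≤ᵇ e + k) (w k * dominatedSum (e + k ∸ c) (d ∸ k) ws cs)
  summand k = begin
    ∑∈ (map (k ∷_) L) h ≡⟨ ∑∈-map (k ∷_) h L ⟩
    ∑[ js ∈ L ] guard ((c ≤ᵇ e + k) ∧ D js) (w k * weightProduct ws js)
      ≡⟨ ∑∈-cong L (λ js → guard-∧ (c ≤ᵇ e + k) (D js) _) ⟩
    ∑[ js ∈ L ] guard (c ≤ᵇ e + k) (guard (D js) (w k * weightProduct ws js))
      ≡⟨ ∑∈-guard (c ≤ᵇ e + k) _ L ⟩
    guard (c ≤ᵇ e + k) (∑[ js ∈ L ] guard (D js) (w k * weightProduct ws js))
      ≡⟨ cong (guard (c ≤ᵇ e + k)) (∑∈-cong L (λ js → sym (guard-*ˡ (D js) (w k) _))) ⟩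
    guard (c ≤ᵇ e + k) (∑[ js ∈ L ] (w k * guard (D js) (weightProduct ws js)))
      ≡⟨ cong (guard (c ≤ᵇ e + k)) (sym (*-distribˡ-∑∈ (w k) _ L)) ⟩
    guard (c ≤ᵇ e + k) (w k * dominatedSum (e + k ∸ c) (d ∸ k) ws cs) ∎
    where
    L = weakComps n (d ∸ k)
    D = dominatesFrom (e + k ∸ c) cs

-- dominatedSum e (sum c ∸ e) ws c, indexed by the surplus r left after the first part.
surplusSum : ∀ {n} → Vec (ℕ → ℕ) n → Vec ℕ n → ℕ → ℕ
surplusSum []       []       zero    = 1
surplusSum []       []       (suc e) = 0
surplusSum (w ∷ ws) (c ∷ cs) e =
  ∑[ r < suc (sum cs) ] guard (e ≤ᵇ c + r) (w (c + r ∸ e) * surplusSum ws cs r)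

-- Both sides are the sum over m of [ e ≤ m ] [ c ≤ m ] w (m ∸ e) * P (m ∸ c).
∑-reindex : ∀ (w P : ℕ → ℕ) c e d L → e + d ≡ c + L →
  ∑[ k < suc d ] guard (c ≤ᵇ e + k) (w k * P (e + k ∸ c))
  ≡ ∑[ r < suc L ] guard (e ≤ᵇ c + r) (w (c + r ∸ e) * P r)
∑-reindex w P c e d L e+d≡c+L = begin
  ∑[ k < suc d ] guard (c ≤ᵇ e + k) (w k * P (e + k ∸ c))
    ≡⟨ ∑-cong (suc d) (λ k → cong (λ i → guard (c ≤ᵇ e + k) (w i * P (e + k ∸ c))) (sym (m+n∸m≡n e k))) ⟩
  ∑[ k < suc d ] G (e + k)                    ≡⟨ sym (∑-shift e (suc d) G) ⟩
  ∑[ m < e + suc d ] guard (e ≤ᵇ m) (G m)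
    ≡⟨ cong (λ N → ∑[ m < N ] guard (e ≤ᵇ m) (G m)) same-range ⟩
  ∑[ m < c + suc L ] guard (e ≤ᵇ m) (G m)
    ≡⟨ ∑-cong (c + suc L) (λ m → guard-comm (e ≤ᵇ m) (c ≤ᵇ m) _) ⟩
  ∑[ m < c + suc L ] guard (c ≤ᵇ m) (H m)     ≡⟨ ∑-shift c (suc L) H ⟩
  ∑[ r < suc L ] H (c + r)
    ≡⟨ ∑-cong (suc L) (λ r → cong (λ i → guard (e ≤ᵇ c + r) (w (c + r ∸ e) * P i)) (m+n∸m≡n c r)) ⟩
  ∑[ r < suc L ] guard (e ≤ᵇ c + r) (w (c + r ∸ e) * P r) ∎
  where
  open ≡-Reasoning
  G H : ℕ → ℕ
  G m = guard (c ≤ᵇ m) (w (m ∸ e) * P (m ∸ c))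
  H m = guard (e ≤ᵇ m) (w (m ∸ e) * P (m ∸ c))
  same-range : e + suc d ≡ c + suc L
  same-range = trans (+-suc e d) (trans (cong suc e+d≡c+L) (sym (+-suc c L)))

dominatedSum≡surplusSum : ∀ {n} (ws : Vec (ℕ → ℕ) n) (cs : Vec ℕ n) e d → e + d ≡ sum cs →
  dominatedSum e d ws cs ≡ surplusSum ws cs e
dominatedSum≡surplusSum []       []       zero zero _ = refl
dominatedSum≡surplusSum (w ∷ ws) (c ∷ cs) e    d    e+d≡c+L = begin
  dominatedSum e d (w ∷ ws) (c ∷ cs)
    ≡⟨ dominatedSum-∷ e d w ws c cs ⟩
  ∑[ k < suc d ] guard (c ≤ᵇ e + k) (w k * dominatedSum (e + k ∸ c) (d ∸ k) ws cs)
    ≡⟨ ∑-cong-< (suc d) summand ⟩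
  ∑[ k < suc d ] guard (c ≤ᵇ e + k) (w k * surplusSum ws cs (e + k ∸ c))
    ≡⟨ ∑-reindex w (surplusSum ws cs) c e d (sum cs) e+d≡c+L ⟩
  surplusSum (w ∷ ws) (c ∷ cs) e ∎
  where
  open ≡-Reasoning
  summand : ∀ k → k < suc d → guard (c ≤ᵇ e + k) (w k * dominatedSum (e + k ∸ c) (d ∸ k) ws cs)
                         ≡ guard (c ≤ᵇ e + k) (w k * surplusSum ws cs (e + k ∸ c))
  summand k k<1+d with c ≤ᵇ e + k in c≤ᵇe+k
  ... | true  = cong (w k *_) (dominatedSum≡surplusSum ws cs (e + k ∸ c) (d ∸ k) (begin
    (e + k ∸ c) + (d ∸ k) ≡⟨ sym (+-∸-comm (d ∸ k) c≤e+k) ⟩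
    (e + k + (d ∸ k)) ∸ c ≡⟨ cong (_∸ c) (trans (+-assoc e k _) (cong (e +_) (m+[n∸m]≡n (m<1+n⇒m≤n k<1+d)))) ⟩
    (e + d) ∸ c           ≡⟨ cong (_∸ c) e+d≡c+L ⟩
    (c + sum cs) ∸ c      ≡⟨ m+n∸m≡n c (sum cs) ⟩
    sum cs                ∎))
    where c≤e+k = ≤ᵇ≡true⇒≤ c (e + k) c≤ᵇe+k
  ... | false = refl

sumDom≡surplusSum : ∀ {n} (ws : Vec (ℕ → ℕ) n) (c : Vec ℕ n) →
  sumDom c (weightProduct ws) ≡ surplusSum ws c 0
sumDom≡surplusSum {n} ws c = begin
  sumDom c (weightProduct ws)
    ≡⟨ ∑∈-filter (dominates? c) (weightProduct ws) (weakComps n (sum c)) ⟩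
  ∑[ j ∈ weakComps n (sum c) ] guard (does (dominates? c j)) (weightProduct ws j)
    ≡⟨ ∑∈-cong (weakComps n (sum c)) (λ j → cong (λ b → guard b (weightProduct ws j)) (does-dominates? c j)) ⟩
  dominatedSum 0 (sum c) ws c ≡⟨ dominatedSum≡surplusSum ws c 0 (sum c) refl ⟩
  surplusSum ws c 0 ∎
  where open ≡-Reasoning

sumDom-cong : ∀ {n} (c : Vec ℕ n) {F G : Vec ℕ n → ℕ} → (∀ j → F j ≡ G j) → sumDom c F ≡ sumDom c G
sumDom-cong {n} c = ∑∈-cong (filter (dominates? c) (weakComps n (sum c)))

-- Counting flows level by level

-- The sum of F x over all ways of writing m = y₁ + ⋯ + y_c + x.
splitSum : ℕ → ℕ → (ℕ → ℕ) → ℕ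
splitSum m zero    F = F m
splitSum m (suc c) F = ∑[ x < suc m ] splitSum x c F

-- The number of flows on a path with sink edges when b units enter the first vertex.
flowCount : ∀ {n} → ℕ → Vec ℕ n → Vec ℕ n → ℕ
flowCount b []       []       = 1
flowCount b (a ∷ as) (c ∷ cs) = splitSum (b + a) c (λ x → flowCount x as cs)

splitSum-∑ : (u : ℕ → ℕ → ℕ → ℕ) (Φ : ℕ → ℕ) (N : ℕ) (F : ℕ → ℕ) →
  (∀ c A r → ∑[ x < suc A ] u c x (c + r) ≡ u (suc c) A (suc c + r)) →
  (∀ A → F A ≡ ∑[ r < N ] (u 0 A r * Φ r)) →
  ∀ c A → splitSum A c F ≡ ∑[ r < N ] (u c A (c + r) * Φ r)
splitSum-∑ u Φ N F u-hockey F-∑ zero    A = F-∑ A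
splitSum-∑ u Φ N F u-hockey F-∑ (suc c) A = begin
  ∑[ x < suc A ] splitSum x c F
    ≡⟨ ∑-cong (suc A) (splitSum-∑ u Φ N F u-hockey F-∑ c) ⟩
  ∑[ x < suc A ] ∑[ r < N ] (u c x (c + r) * Φ r)
    ≡⟨ ∑-comm (suc A) N (λ x r → u c x (c + r) * Φ r) ⟩
  ∑[ r < N ] ∑[ x < suc A ] (u c x (c + r) * Φ r)
    ≡⟨ ∑-cong N (λ r → sym (*-distribʳ-∑ (suc A) (Φ r) (λ x → u c x (c + r)))) ⟩
  ∑[ r < N ] (∑[ x < suc A ] u c x (c + r) * Φ r)
    ≡⟨ ∑-cong N (λ r → cong (_* Φ r) (u-hockey c A r)) ⟩
  ∑[ r < N ] (u (suc c) A (suc c + r) * Φ r) ∎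
  where open ≡-Reasoning

∑-*-surplusSum : ∀ {n} (p w : ℕ → ℕ) (ws : Vec (ℕ → ℕ) n) c cs →
  ∑[ r < suc (c + sum cs) ] (p r * surplusSum (w ∷ ws) (c ∷ cs) r)
  ≡ ∑[ s < suc (sum cs) ] (∑[ r < suc (c + s) ] (p r * w (c + s ∸ r)) * surplusSum ws cs s)
∑-*-surplusSum p w ws c cs = begin
  ∑[ r < N ] (p r * ∑[ s < suc L ] guard (r ≤ᵇ c + s) (w (c + s ∸ r) * R s))
    ≡⟨ ∑-cong N (λ r → *-distribˡ-∑ (suc L) (p r) (λ s → guard (r ≤ᵇ c + s) (w (c + s ∸ r) * R s))) ⟩
  ∑[ r < N ] ∑[ s < suc L ] (p r * guard (r ≤ᵇ c + s) (w (c + s ∸ r) * R s))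
    ≡⟨ ∑-comm N (suc L) (λ r s → p r * guard (r ≤ᵇ c + s) (w (c + s ∸ r) * R s)) ⟩
  ∑[ s < suc L ] ∑[ r < N ] (p r * guard (r ≤ᵇ c + s) (w (c + s ∸ r) * R s))
    ≡⟨ ∑-cong (suc L) (λ s → ∑-cong N (λ r → trans (guard-*ˡ (r ≤ᵇ c + s) (p r) _)
         (cong (guard (r ≤ᵇ c + s)) (sym (*-assoc (p r) (w (c + s ∸ r)) (R s)))))) ⟩
  ∑[ s < suc L ] ∑[ r < N ] guard (r ≤ᵇ c + s) (p r * w (c + s ∸ r) * R s)
    ≡⟨ ∑-cong-< (suc L) (λ s s<1+L → ∑-truncate N (c + s) (λ r → p r * w (c + s ∸ r) * R s)
         (s≤s (+-monoʳ-≤ c (m<1+n⇒m≤n s<1+L)))) ⟩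
  ∑[ s < suc L ] ∑[ r < suc (c + s) ] (p r * w (c + s ∸ r) * R s)
    ≡⟨ ∑-cong (suc L) (λ s → sym (*-distribʳ-∑ (suc (c + s)) (R s) (λ r → p r * w (c + s ∸ r)))) ⟩
  ∑[ s < suc L ] (∑[ r < suc (c + s) ] (p r * w (c + s ∸ r)) * R s) ∎
  where
  open ≡-Reasoning
  L = sum cs
  N = suc (c + L)
  R = surplusSum ws cs

-- U c A weighs the first part when A units enter it, V c a each later part.
module _ (U V : ℕ → ℕ → ℕ → ℕ)
         (U-hockey : ∀ c A r → ∑[ x < suc A ] U c x (c + r) ≡ U (suc c) A (suc c + r))
         (U-vandermonde : ∀ A a c k → U c (A + a) k ≡ ∑[ r < suc k ] (U 0 A r * V c a (k ∸ r)))
         (U-zero : ∀ A → U 0 A 0 ≡ 1)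
  where

  flowCount≡surplusSum : ∀ {n} b a c (as cs : Vec ℕ n) →
    flowCount b (a ∷ as) (c ∷ cs) ≡ surplusSum (U c (b + a) ∷ Vec.zipWith V cs as) (c ∷ cs) 0
  flowCount≡surplusSum b a c [] [] =
    splitSum-∑ U (surplusSum [] []) 1 (λ _ → 1) U-hockey
      (λ A → sym (trans (+-identityʳ _) (trans (*-identityʳ _) (U-zero A)))) c (b + a)
  flowCount≡surplusSum b a c (a₂ ∷ as) (c₂ ∷ cs) =
    splitSum-∑ U Φ (suc (c₂ + L)) (λ x → flowCount x (a₂ ∷ as) (c₂ ∷ cs)) U-hockey base c (b + a)
    where
    open ≡-Reasoning
    L = sum cs
    R = surplusSum (Vec.zipWith V cs as) cs
    Φ = surplusSum (Vec.zipWith V (c₂ ∷ cs) (a₂ ∷ as)) (c₂ ∷ cs)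
    base : ∀ A → flowCount A (a₂ ∷ as) (c₂ ∷ cs) ≡ ∑[ r < suc (c₂ + L) ] (U 0 A r * Φ r)
    base A = begin
      flowCount A (a₂ ∷ as) (c₂ ∷ cs)
        ≡⟨ flowCount≡surplusSum A a₂ c₂ as cs ⟩
      ∑[ s < suc L ] (U c₂ (A + a₂) (c₂ + s) * R s)
        ≡⟨ ∑-cong (suc L) (λ s → cong (_* R s) (U-vandermonde A a₂ c₂ (c₂ + s))) ⟩
      ∑[ s < suc L ] (∑[ r < suc (c₂ + s) ] (U 0 A r * V c₂ a₂ (c₂ + s ∸ r)) * R s)
        ≡⟨ sym (∑-*-surplusSum (U 0 A) (V c₂ a₂) (Vec.zipWith V cs as) c₂ cs) ⟩
      ∑[ r < suc (c₂ + L) ] (U 0 A r * Φ r) ∎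

  sumDom≡flowCount : ∀ {n} a c (as cs : Vec ℕ n) {F : Vec ℕ (suc n) → ℕ} →
    (∀ j → F j ≡ weightProduct (U c a ∷ Vec.zipWith V cs as) j) →
    sumDom (c ∷ cs) F ≡ flowCount 0 (a ∷ as) (c ∷ cs)
  sumDom≡flowCount a c as cs {F} F≗weightProduct = begin
    sumDom (c ∷ cs) F                                               ≡⟨ sumDom-cong (c ∷ cs) F≗weightProduct ⟩
    sumDom (c ∷ cs) (weightProduct (U c a ∷ Vec.zipWith V cs as))   ≡⟨ sumDom≡surplusSum _ (c ∷ cs) ⟩
    surplusSum (U c a ∷ Vec.zipWith V cs as) (c ∷ cs) 0             ≡⟨ flowCount≡surplusSum 0 a c as cs ⟨
    flowCount 0 (a ∷ as) (c ∷ cs)                                   ∎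
    where open ≡-Reasoning

-- The two counting formulas

binomialWeight : ℕ → ℕ → ℕ → ℕ
binomialWeight c a k = (a + c) C k

binomialWeight-hockey : ∀ c A r →
  ∑[ x < suc A ] binomialWeight c x (c + r) ≡ binomialWeight (suc c) A (suc c + r)
binomialWeight-hockey c A r =
  trans (hockey-stick A c (c + r) (m≤m+n c r)) (cong (_C suc (c + r)) (sym (+-suc A c)))

binomialWeight-vandermonde : ∀ A a c k →
  binomialWeight c (A + a) k ≡ ∑[ r < suc k ] (binomialWeight 0 A r * binomialWeight c a (k ∸ r))
binomialWeight-vandermonde A a c k =
  trans (cong (_C k) (trans (+-assoc A a c) (cong (_+ (a + c)) (sym (+-identityʳ A)))))
        (sym (vandermonde (A + 0) (a + c) k))

multisetWeight : ℕ → ℕ → ℕ → ℕ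
multisetWeight c a k = multichoose a k

shiftedMultisetWeight : ℕ → ℕ → ℕ → ℕ
shiftedMultisetWeight c A k = multichoose (suc A) k

shiftedMultisetWeight-hockey : ∀ c A r →
  ∑[ x < suc A ] shiftedMultisetWeight c x (c + r) ≡ shiftedMultisetWeight (suc c) A (suc c + r)
shiftedMultisetWeight-hockey c A r =
  trans (hockey-stick A (c + r) (c + r) ≤-refl) (cong (_C suc (c + r)) (sym (+-suc A (c + r))))

shiftedMultisetWeight-vandermonde : ∀ A a c k →
  shiftedMultisetWeight c (A + a) k ≡ ∑[ r < suc k ] (shiftedMultisetWeight 0 A r * multisetWeight c a (k ∸ r))
shiftedMultisetWeight-vandermonde A a c k = sym (vandermonde-multichoose (suc A) a k)

binomialProduct : ∀ {n} → Vec ℕ n → Vec ℕ n → Vec ℕ n → ℕ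
binomialProduct a c j = Vec.foldr _ _*_ 1 (Vec.zipWith _C_ (Vec.zipWith _+_ a c) j)

multisetProduct : ∀ {n} → Vec ℕ n → Vec ℕ n → ℕ
multisetProduct a j = Vec.foldr _ _*_ 1 (Vec.zipWith multichoose a j)

binomialProduct≡weightProduct : ∀ {n} (a c j : Vec ℕ n) →
  binomialProduct a c j ≡ weightProduct (Vec.zipWith binomialWeight c a) j
binomialProduct≡weightProduct []       []       []       = refl
binomialProduct≡weightProduct (a ∷ as) (c ∷ cs) (j ∷ js) =
  cong (((a + c) C j) *_) (binomialProduct≡weightProduct as cs js)

multisetProduct≡weightProduct : ∀ {n} (a c j : Vec ℕ n) →
  multisetProduct a j ≡ weightProduct (Vec.zipWith multisetWeight c a) j
multisetProduct≡weightProduct []       []       []       = refl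
multisetProduct≡weightProduct (a ∷ as) (c ∷ cs) (j ∷ js) =
  cong (multichoose a j *_) (multisetProduct≡weightProduct as cs js)

countRHS₁≡flowCount : ∀ {n} (a c : Vec ℕ (suc n)) → countRHS₁ a c ≡ flowCount 0 a c
countRHS₁≡flowCount (a ∷ as) (c ∷ cs) =
  sumDom≡flowCount binomialWeight binomialWeight binomialWeight-hockey binomialWeight-vandermonde (λ _ → refl)
    a c as cs (binomialProduct≡weightProduct (a ∷ as) (c ∷ cs))

countRHS₂≡flowCount : ∀ {n} (a c : Vec ℕ (suc n)) → countRHS₂ a c ≡ flowCount 0 a c
countRHS₂≡flowCount (a ∷ as) (c ∷ cs) =
  sumDom≡flowCount shiftedMultisetWeight multisetWeight shiftedMultisetWeight-hockey shiftedMultisetWeight-vandermonde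
    (λ _ → refl) a c as cs λ { (j ∷ js) →
      cong₂ _*_ (cong (λ p → multichoose p j) (+-comm a 1)) (multisetProduct≡weightProduct as cs js) }

-- Integer flows on Π_n(c)

Fin-∑↔Σ : ∀ N (f : ℕ → ℕ) → Fin (∑< N f) ↔ (Σ[ i ∈ ℕ ] (i < N × Fin (f i)))
Fin-∑↔Σ zero    f = mk↔ₛ′ (λ ()) (λ { (_ , () , _) }) (λ { (_ , () , _) }) (λ ())
Fin-∑↔Σ (suc N) f = ↔-trans +↔⊎ (↔-trans (↔-refl ⊎-↔ Fin-∑↔Σ N (f ∘ suc)) peel)
  where
  peel : (Fin (f 0) ⊎ (Σ[ i ∈ ℕ ] (i < N × Fin (f (suc i))))) ↔ (Σ[ i ∈ ℕ ] (i < suc N × Fin (f i)))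
  peel = mk↔ₛ′
    (λ { (inj₁ k) → 0 , z<s , k ; (inj₂ (i , i<N , k)) → suc i , s<s i<N , k })
    (λ { (zero , _ , k) → inj₁ k ; (suc i , s<s i<N , k) → inj₂ (i , i<N , k) })
    (λ { (zero , s≤s z≤n , k) → refl ; (suc i , s<s i<N , k) → refl })
    (λ { (inj₁ k) → refl ; (inj₂ (i , i<N , k)) → refl })

Splits : ℕ → ℕ → (ℕ → Set) → Set
Splits m c B = Σ[ x ∈ ℕ ] Σ[ y ∈ Vec ℕ c ] (sum y + x ≡ m × B x)

Splits-cong : ∀ m c {B B′ : ℕ → Set} → (∀ x → B x ↔ B′ x) → Splits m c B ↔ Splits m c B′
Splits-cong m c B↔B′ = Σ-↔ ↔-refl (Σ-↔ ↔-refl (↔-refl ×-↔ B↔B′ _))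

Splits-≡ : ∀ {m c B x} {y y′ : Vec ℕ c} {eq eq′} {b : B x} →
  y ≡ y′ → _≡_ {A = Splits m c B} (x , y , eq , b) (x , y′ , eq′ , b)
Splits-≡ {x = x} {y} {b = b} refl = cong (λ eq → x , y , eq , b) (≡-irrelevant _ _)

Splits-suc : ∀ m c B → (Σ[ x′ ∈ ℕ ] (x′ < suc m × Splits x′ c B)) ↔ Splits m (suc c) B
Splits-suc m c B = mk↔ₛ′ to from to∘from from∘to
  where
  open ≡-Reasoning
  to : Σ[ x′ ∈ ℕ ] (x′ < suc m × Splits x′ c B) → Splits m (suc c) B
  to (x′ , x′<1+m , x , y , eq , b) = x , (m ∸ x′) ∷ y , (begin
    m ∸ x′ + sum y + x   ≡⟨ +-assoc (m ∸ x′) (sum y) x ⟩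
    m ∸ x′ + (sum y + x) ≡⟨ cong (λ z → m ∸ x′ + z) eq ⟩
    m ∸ x′ + x′          ≡⟨ m∸n+n≡m (m<1+n⇒m≤n x′<1+m) ⟩
    m                    ∎) , b
  from : Splits m (suc c) B → Σ[ x′ ∈ ℕ ] (x′ < suc m × Splits x′ c B)
  from (x , y₀ ∷ y , eq , b) =
    sum y + x , s≤s (≤-trans (m≤n+m _ y₀) (≤-reflexive (trans (sym (+-assoc y₀ (sum y) x)) eq))) ,
    x , y , refl , b
  to∘from : ∀ s → to (from s) ≡ s
  to∘from (x , y₀ ∷ y , eq , b) = Splits-≡ (cong (_∷ y) (begin
    m ∸ (sum y + x)                ≡⟨ cong (_∸ (sum y + x)) eq ⟨
    y₀ + sum y + x ∸ (sum y + x)   ≡⟨ cong (_∸ (sum y + x)) (+-assoc y₀ (sum y) x) ⟩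
    y₀ + (sum y + x) ∸ (sum y + x) ≡⟨ m+n∸n≡m y₀ (sum y + x) ⟩
    y₀                             ∎))
  from∘to : ∀ s → from (to s) ≡ s
  from∘to (x′ , _ , x , y , refl , b) = cong (λ lt → sum y + x , lt , x , y , refl , b) (<-irrelevant _ _)

Fin-splitSum↔Splits : ∀ m c (F : ℕ → ℕ) → Fin (splitSum m c F) ↔ Splits m c (Fin ∘ F)
Fin-splitSum↔Splits m zero    F = mk↔ₛ′ (λ k → m , [] , refl , k) (λ { (x , [] , refl , k) → k })
  (λ { (x , [] , refl , k) → refl }) (λ k → refl)
Fin-splitSum↔Splits m (suc c) F = ↔-trans (Fin-∑↔Σ (suc m) (λ x → splitSum x c F))
  (↔-trans (Σ-↔ ↔-refl (↔-refl ×-↔ Fin-splitSum↔Splits _ c F)) (Splits-suc m c (Fin ∘ F)))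

Blocks : ∀ {n} → Vec ℕ n → Set
Blocks []       = ⊤
Blocks (c ∷ cs) = Vec ℕ c × Blocks cs

Conserved : ∀ {n} → ℕ → Vec ℕ n → (c : Vec ℕ n) → Vec ℕ n → Blocks c → Set
Conserved b []       []       []       tt       = ⊤
Conserved b (a ∷ as) (c ∷ cs) (x ∷ xs) (y , ys) = (sum y + x ≡ b + a) × Conserved x as cs xs ys

FlowData : ∀ {n} → ℕ → Vec ℕ n → Vec ℕ n → Set
FlowData {n} b a c = Σ (Vec ℕ n × Blocks c) (uncurry (Conserved b a c))

Splits-FlowData↔FlowData : ∀ {n} b a c (as cs : Vec ℕ n) →
  Splits (b + a) c (λ x → FlowData x as cs) ↔ FlowData b (a ∷ as) (c ∷ cs)
Splits-FlowData↔FlowData b a c as cs = mk↔ₛ′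
  (λ { (x , y , eq , ((xs , ys) , cons)) → (x ∷ xs , (y , ys)) , (eq , cons) })
  (λ { ((x ∷ xs , (y , ys)) , (eq , cons)) → x , y , eq , ((xs , ys) , cons) })
  (λ { ((x ∷ xs , (y , ys)) , (eq , cons)) → refl })
  (λ { (x , y , eq , ((xs , ys) , cons)) → refl })

Fin-flowCount↔FlowData : ∀ {n} b (a c : Vec ℕ n) → Fin (flowCount b a c) ↔ FlowData b a c
Fin-flowCount↔FlowData b []       []       =
  mk↔ₛ′ (λ _ → ([] , tt) , tt) (λ _ → zero) (λ { (([] , tt) , tt) → refl }) (λ { zero → refl })
Fin-flowCount↔FlowData b (a ∷ as) (c ∷ cs) =
  ↔-trans (Fin-splitSum↔Splits (b + a) c (λ x → flowCount x as cs))
  (↔-trans (Splits-cong (b + a) c (λ x → Fin-flowCount↔FlowData x as cs))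
           (Splits-FlowData↔FlowData b a c as cs))

path : ℕ → ℕ → Graph
path o zero    = []
path o (suc m) = (o , suc o) ∷ path (suc o) m

sinkEdges : ∀ {n} → ℕ → ℕ → Vec ℕ n → Graph
sinkEdges o t []       = []
sinkEdges o t (c ∷ cs) = replicate c (o , t) ++ sinkEdges (suc o) t cs

applyUpTo≡path : ∀ o m → applyUpTo (λ i → o + i , suc (o + i)) m ≡ path o m
applyUpTo≡path o zero    = refl
applyUpTo≡path o (suc m) = cong₂ _∷_ (cong (λ v → v , suc v) (+-identityʳ o)) (begin
  applyUpTo (λ i → o + suc i , suc (o + suc i)) m ≡⟨ sym (map-upTo _ m) ⟩
  map (λ i → o + suc i , suc (o + suc i)) (upTo m)
    ≡⟨ map-cong (λ i → cong (λ v → v , suc v) (+-suc o i)) (upTo m) ⟩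
  map (λ i → suc o + i , suc (suc o + i)) (upTo m) ≡⟨ map-upTo _ m ⟩
  applyUpTo (λ i → suc o + i , suc (suc o + i)) m ≡⟨ applyUpTo≡path (suc o) m ⟩
  path (suc o) m                                  ∎)
  where open ≡-Reasoning

concat-tabulate≡sinkEdges : ∀ {n} o t (c : Vec ℕ n) →
  concat (tabulate (λ i → replicate (lookup c i) (o + toℕ i , t))) ≡ sinkEdges o t c
concat-tabulate≡sinkEdges o t []       = refl
concat-tabulate≡sinkEdges o t (c ∷ cs) = cong₂ _++_
  (cong (λ v → replicate c (v , t)) (+-identityʳ o))
  (trans (cong concat (tabulate-cong (λ i → cong (λ v → replicate (lookup cs i) (v , t)) (+-suc o (toℕ i)))))
         (concat-tabulate≡sinkEdges (suc o) t cs))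

Pi≡path++sinkEdges : ∀ n (c : Vec ℕ n) → Pi n c ≡ path 1 n ++ sinkEdges 1 (suc n) c
Pi≡path++sinkEdges n c = cong₂ _++_
  (trans (map-upTo _ n) (applyUpTo≡path 1 n))
  (trans (cong concat (map-tabulate id (λ i → replicate (lookup c i) (suc (toℕ i) , suc n))))
         (concat-tabulate≡sinkEdges 1 (suc n) c))

Vec-cast↔ : ∀ {A : Set} {m n} → m ≡ n → Vec A m ↔ Vec A n
Vec-cast↔ eq =
  mk↔ₛ′ (Vec.cast eq) (Vec.cast (sym eq)) (λ _ → cast-sym (sym eq) refl) (λ _ → cast-sym eq refl)

joinFlow : ∀ A B → Flow A → Flow B → Flow (A ++ B)
joinFlow []      B []      q = q
joinFlow (e ∷ A) B (x ∷ p) q = x ∷ joinFlow A B p q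

splitFlow : ∀ A B → Flow (A ++ B) → Flow A × Flow B
splitFlow []      B f       = [] , f
splitFlow (e ∷ A) B (x ∷ f) = let p , q = splitFlow A B f in x ∷ p , q

Flow-++↔ : ∀ A B → (Flow A × Flow B) ↔ Flow (A ++ B)
Flow-++↔ A B = mk↔ₛ′ (uncurry (joinFlow A B)) (splitFlow A B) (join∘split A) (split∘join A)
  where
  join∘split : ∀ A f → uncurry (joinFlow A B) (splitFlow A B f) ≡ f
  join∘split []      f       = refl
  join∘split (e ∷ A) (x ∷ f) = cong (x ∷_) (join∘split A f)
  split∘join : ∀ A pq → splitFlow A B (uncurry (joinFlow A B) pq) ≡ pq
  split∘join []      ([]      , q) = refl
  split∘join (e ∷ A) (x ∷ p , q)   = cong (λ (p , q) → x ∷ p , q) (split∘join A (p , q))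

length-path : ∀ o m → length (path o m) ≡ m
length-path o zero    = refl
length-path o (suc m) = cong suc (length-path (suc o) m)

Blocks↔Flow : ∀ {n} o t (c : Vec ℕ n) → Blocks c ↔ Flow (sinkEdges o t c)
Blocks↔Flow o t []       = mk↔ₛ′ (λ _ → []) (λ _ → tt) (λ { [] → refl }) (λ _ → refl)
Blocks↔Flow o t (c ∷ cs) =
  ↔-trans (Vec-cast↔ (sym (length-replicate c)) ×-↔ Blocks↔Flow (suc o) t cs)
          (Flow-++↔ (replicate c (o , t)) (sinkEdges (suc o) t cs))

rawFlow↔ : ∀ {n} o t (c : Vec ℕ n) → (Vec ℕ n × Blocks c) ↔ Flow (path o n ++ sinkEdges o t c)
rawFlow↔ {n} o t c = ↔-trans (Vec-cast↔ (sym (length-path o n)) ×-↔ Blocks↔Flow o t c)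
                             (Flow-++↔ (path o n) (sinkEdges o t c))

pathFlow : ∀ o m → Vec ℕ m → Flow (path o m)
pathFlow o m = Vec.cast (sym (length-path o m))

sinkFlow : ∀ {n} o t (c : Vec ℕ n) → Blocks c → Flow (sinkEdges o t c)
sinkFlow o t c = Inverse.to (Blocks↔Flow o t c)

nth : ∀ {n} → Vec ℕ n → ℕ → ℕ
nth []       k       = 0
nth (x ∷ xs) zero    = x
nth (x ∷ xs) (suc k) = nth xs k

blockSums : ∀ {n} {c : Vec ℕ n} → Blocks c → Vec ℕ n
blockSums {c = []}    tt       = []
blockSums {c = _ ∷ _} (y , ys) = sum y ∷ blockSums ys

≡ᵇ-refl : ∀ n → (n ≡ᵇ n) ≡ true
≡ᵇ-refl n = Equivalence.to T-≡ (≡⇒≡ᵇ n n refl)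

≢⇒≡ᵇ≡false : ∀ {m n} → m ≢ n → (m ≡ᵇ n) ≡ false
≢⇒≡ᵇ≡false m≢n = ¬-not (λ eq → m≢n (≡ᵇ⇒≡ _ _ (Equivalence.from T-≡ eq)))

if-same : ∀ (b : Bool) {y : ℕ} → (if b then y else y) ≡ y
if-same true  = refl
if-same false = refl

outflow-++ : ∀ A B p q v → outflow (A ++ B) (joinFlow A B p q) v ≡ outflow A p v + outflow B q v
outflow-++ []            B []      q v = refl
outflow-++ ((s , _) ∷ A) B (x ∷ p) q v =
  trans (cong ((if s ≡ᵇ v then x else 0) +_) (outflow-++ A B p q v))
        (sym (+-assoc (if s ≡ᵇ v then x else 0) _ _))

inflow-++ : ∀ A B p q v → inflow (A ++ B) (joinFlow A B p q) v ≡ inflow A p v + inflow B q v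
inflow-++ []            B []      q v = refl
inflow-++ ((_ , t) ∷ A) B (x ∷ p) q v =
  trans (cong ((if t ≡ᵇ v then x else 0) +_) (inflow-++ A B p q v))
        (sym (+-assoc (if t ≡ᵇ v then x else 0) _ _))

outflow-path-< : ∀ o m x v → v < o → outflow (path o m) (pathFlow o m x) v ≡ 0
outflow-path-< o zero    []       v v<o = refl
outflow-path-< o (suc m) (x ∷ xs) v v<o rewrite ≢⇒≡ᵇ≡false (>⇒≢ v<o) =
  outflow-path-< (suc o) m xs v (m<n⇒m<1+n v<o)

outflow-path : ∀ o m x k → outflow (path o m) (pathFlow o m x) (o + k) ≡ nth x k
outflow-path o zero    []       k       = refl
outflow-path o (suc m) (x ∷ xs) zero
  rewrite +-identityʳ o | ≡ᵇ-refl o | outflow-path-< (suc o) m xs o ≤-refl = +-identityʳ x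
outflow-path o (suc m) (x ∷ xs) (suc k)
  rewrite +-suc o k | ≢⇒≡ᵇ≡false (<⇒≢ (s≤s (m≤m+n o k))) = outflow-path (suc o) m xs k

inflow-path-≤ : ∀ o m x v → v ≤ o → inflow (path o m) (pathFlow o m x) v ≡ 0
inflow-path-≤ o zero    []       v v≤o = refl
inflow-path-≤ o (suc m) (x ∷ xs) v v≤o rewrite ≢⇒≡ᵇ≡false (>⇒≢ (s≤s v≤o)) =
  inflow-path-≤ (suc o) m xs v (m≤n⇒m≤1+n v≤o)

inflow-path : ∀ o m x k → inflow (path o m) (pathFlow o m x) (o + k) ≡ nth (0 ∷ x) k
inflow-path o m       x        zero          = inflow-path-≤ o m x (o + 0) (≤-reflexive (+-identityʳ o))
inflow-path o zero    []       (suc k)       = refl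
inflow-path o (suc m) (x ∷ xs) (suc zero)
  rewrite +-suc o 0 | +-identityʳ o | ≡ᵇ-refl o | inflow-path-≤ (suc o) m xs (suc o) ≤-refl = +-identityʳ x
inflow-path o (suc m) (x ∷ xs) (suc (suc k))
  rewrite +-suc o (suc k) | ≢⇒≡ᵇ≡false (<⇒≢ (m<m+n o (s≤s (z≤n {k})))) = inflow-path (suc o) m xs (suc k)

outflow-replicate : ∀ c o t (y : Vec ℕ c) v →
  outflow (replicate c (o , t)) (Vec.cast (sym (length-replicate c)) y) v ≡ (if o ≡ᵇ v then sum y else 0)
outflow-replicate zero    o t []       v = sym (if-same (o ≡ᵇ v))
outflow-replicate (suc c) o t (y ∷ ys) v with o ≡ᵇ v in o≡ᵇv
... | true  = cong (y +_) (trans (outflow-replicate c o t ys v) (cong (λ b → if b then sum ys else 0) o≡ᵇv))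
... | false = trans (outflow-replicate c o t ys v) (cong (λ b → if b then sum ys else 0) o≡ᵇv)

inflow-replicate : ∀ c o t (y : Vec ℕ c) v → (t ≡ᵇ v) ≡ false →
  inflow (replicate c (o , t)) (Vec.cast (sym (length-replicate c)) y) v ≡ 0
inflow-replicate zero    o t []       v t≢v = refl
inflow-replicate (suc c) o t (y ∷ ys) v t≢v rewrite t≢v = inflow-replicate c o t ys v t≢v

outflow-sink-∷ : ∀ {n} o t c (cs : Vec ℕ n) y ys v →
  outflow (sinkEdges o t (c ∷ cs)) (sinkFlow o t (c ∷ cs) (y , ys)) v
  ≡ (if o ≡ᵇ v then sum y else 0) + outflow (sinkEdges (suc o) t cs) (sinkFlow (suc o) t cs ys) v
outflow-sink-∷ o t c cs y ys v =
  trans (outflow-++ (replicate c (o , t)) (sinkEdges (suc o) t cs) _ (sinkFlow (suc o) t cs ys) v)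
        (cong (_+ _) (outflow-replicate c o t y v))

inflow-sink-∷ : ∀ {n} o t c (cs : Vec ℕ n) y ys v → (t ≡ᵇ v) ≡ false →
  inflow (sinkEdges o t (c ∷ cs)) (sinkFlow o t (c ∷ cs) (y , ys)) v
  ≡ inflow (sinkEdges (suc o) t cs) (sinkFlow (suc o) t cs ys) v
inflow-sink-∷ o t c cs y ys v t≢v =
  trans (inflow-++ (replicate c (o , t)) (sinkEdges (suc o) t cs) _ (sinkFlow (suc o) t cs ys) v)
        (cong (_+ _) (inflow-replicate c o t y v t≢v))

outflow-sink-< : ∀ {n} o t (c : Vec ℕ n) ys v → v < o →
  outflow (sinkEdges o t c) (sinkFlow o t c ys) v ≡ 0
outflow-sink-< o t []       tt       v v<o = refl
outflow-sink-< o t (c ∷ cs) (y , ys) v v<o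
  rewrite outflow-sink-∷ o t c cs y ys v | ≢⇒≡ᵇ≡false (>⇒≢ v<o) = outflow-sink-< (suc o) t cs ys v (m<n⇒m<1+n v<o)

outflow-sink : ∀ {n} o t (c : Vec ℕ n) ys k →
  outflow (sinkEdges o t c) (sinkFlow o t c ys) (o + k) ≡ nth (blockSums ys) k
outflow-sink o t []       tt       k       = refl
outflow-sink o t (c ∷ cs) (y , ys) zero
  rewrite outflow-sink-∷ o t c cs y ys (o + 0) | +-identityʳ o | ≡ᵇ-refl o
        | outflow-sink-< (suc o) t cs ys o ≤-refl = +-identityʳ _
outflow-sink o t (c ∷ cs) (y , ys) (suc k)
  rewrite outflow-sink-∷ o t c cs y ys (o + suc k) | +-suc o k | ≢⇒≡ᵇ≡false (<⇒≢ (s≤s (m≤m+n o k))) =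
  outflow-sink (suc o) t cs ys k

inflow-sink : ∀ {n} o t (c : Vec ℕ n) ys v → (t ≡ᵇ v) ≡ false →
  inflow (sinkEdges o t c) (sinkFlow o t c ys) v ≡ 0
inflow-sink o t []       tt       v t≢v = refl
inflow-sink o t (c ∷ cs) (y , ys) v t≢v =
  trans (inflow-sink-∷ o t c cs y ys v t≢v) (inflow-sink (suc o) t cs ys v t≢v)

+m-+n≡+o⇒m≡n+o : ∀ p q r → ℤ.+ p ℤ.- ℤ.+ q ≡ ℤ.+ r → p ≡ q + r
+m-+n≡+o⇒m≡n+o p q r eq = ℤ.+-injective (begin
  ℤ.+ p                             ≡⟨ minus-plus (ℤ.+ p) (ℤ.+ q) ⟩
  ℤ.+ q ℤ.+ (ℤ.+ p ℤ.- ℤ.+ q)       ≡⟨ cong (λ z → ℤ.+ q ℤ.+ z) eq ⟩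
  ℤ.+ q ℤ.+ ℤ.+ r                   ≡⟨ ℤ.pos-+ q r ⟨
  ℤ.+ (q + r)                       ∎)
  where
  open ≡-Reasoning
  minus-plus : ∀ x y → x ≡ y ℤ.+ (x ℤ.- y)
  minus-plus = ℤ-Solver.solve-∀

m≡n+o⇒+m-+n≡+o : ∀ p q r → p ≡ q + r → ℤ.+ p ℤ.- ℤ.+ q ≡ ℤ.+ r
m≡n+o⇒+m-+n≡+o .(q + r) q r refl = begin
  ℤ.+ (q + r) ℤ.- ℤ.+ q ≡⟨ ℤ.m-n≡m⊖n (q + r) q ⟩
  (q + r) ℤ.⊖ q         ≡⟨ ℤ.⊖-≥ (m≤m+n q r) ⟩
  ℤ.+ (q + r ∸ q)       ≡⟨ cong ℤ.+_ (m+n∸m≡n q r) ⟩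
  ℤ.+ r                 ∎
  where open ≡-Reasoning

Conserved⇒nth : ∀ {n} b (a c : Vec ℕ n) xs ys → Conserved b a c xs ys →
  ∀ i → nth (blockSums ys) (toℕ i) + nth xs (toℕ i) ≡ nth (b ∷ xs) (toℕ i) + lookup a i
Conserved⇒nth b (a ∷ as) (c ∷ cs) (x ∷ xs) (y , ys) (eq , cons) zero    = eq
Conserved⇒nth b (a ∷ as) (c ∷ cs) (x ∷ xs) (y , ys) (eq , cons) (suc i) = Conserved⇒nth x as cs xs ys cons i

nth⇒Conserved : ∀ {n} b (a c : Vec ℕ n) xs ys →
  (∀ i → nth (blockSums ys) (toℕ i) + nth xs (toℕ i) ≡ nth (b ∷ xs) (toℕ i) + lookup a i) →
  Conserved b a c xs ys
nth⇒Conserved b []       []       []       tt       eqs = tt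
nth⇒Conserved b (a ∷ as) (c ∷ cs) (x ∷ xs) (y , ys) eqs = eqs zero , nth⇒Conserved x as cs xs ys (eqs ∘ suc)

Conserved-irrelevant : ∀ {n} b (a c : Vec ℕ n) xs ys → Irrelevant (Conserved b a c xs ys)
Conserved-irrelevant b []       []       []       tt       tt          tt            = refl
Conserved-irrelevant b (a ∷ as) (c ∷ cs) (x ∷ xs) (y , ys) (eq , cons) (eq′ , cons′) =
  cong₂ _,_ (≡-irrelevant eq eq′) (Conserved-irrelevant x as cs xs ys cons cons′)

IsFlow-irrelevant : ∀ G {n} (a : Vec ℕ n) f → Irrelevant (IsFlow G a f)
IsFlow-irrelevant G a f = All.irrelevant (Decidable⇒UIP.≡-irrelevant ℤ._≟_)

module _ {n} (a c : Vec ℕ n) (xs : Vec ℕ n) (ys : Blocks c) where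
  private
    G = path 1 n ++ sinkEdges 1 (suc n) c
    f = Inverse.to (rawFlow↔ 1 (suc n) c) (xs , ys)

  outflow-vertex : ∀ k → outflow G f (suc k) ≡ nth (blockSums ys) k + nth xs k
  outflow-vertex k = begin
    outflow G f (suc k)                    ≡⟨ outflow-++ (path 1 n) (sinkEdges 1 (suc n) c) _ _ (suc k) ⟩
    outflow (path 1 n) _ (suc k) + outflow (sinkEdges 1 (suc n) c) _ (suc k)
      ≡⟨ cong₂ _+_ (outflow-path 1 n xs k) (outflow-sink 1 (suc n) c ys k) ⟩
    nth xs k + nth (blockSums ys) k        ≡⟨ +-comm (nth xs k) _ ⟩
    nth (blockSums ys) k + nth xs k        ∎
    where open ≡-Reasoning

  inflow-vertex : ∀ k → k < n → inflow G f (suc k) ≡ nth (0 ∷ xs) k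
  inflow-vertex k k<n = begin
    inflow G f (suc k)                    ≡⟨ inflow-++ (path 1 n) (sinkEdges 1 (suc n) c) _ _ (suc k) ⟩
    inflow (path 1 n) _ (suc k) + inflow (sinkEdges 1 (suc n) c) _ (suc k)
      ≡⟨ cong₂ _+_ (inflow-path 1 n xs k)
                   (inflow-sink 1 (suc n) c ys (suc k) (≢⇒≡ᵇ≡false (>⇒≢ (s<s k<n)))) ⟩
    nth (0 ∷ xs) k + 0                    ≡⟨ +-identityʳ _ ⟩
    nth (0 ∷ xs) k                        ∎
    where open ≡-Reasoning

  Conserved↔IsFlow : Conserved 0 a c xs ys ↔ IsFlow G a f
  Conserved↔IsFlow =
    mk↔ₛ′ to from (λ _ → IsFlow-irrelevant G a f _ _) (λ _ → Conserved-irrelevant 0 a c xs ys _ _)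
    where
    open ≡-Reasoning
    to : Conserved 0 a c xs ys → IsFlow G a f
    to cons = tabulate⁺ λ i → m≡n+o⇒+m-+n≡+o _ _ _ (begin
      outflow G f (suc (toℕ i))                             ≡⟨ outflow-vertex (toℕ i) ⟩
      nth (blockSums ys) (toℕ i) + nth xs (toℕ i)           ≡⟨ Conserved⇒nth 0 a c xs ys cons i ⟩
      nth (0 ∷ xs) (toℕ i) + lookup a i                     ≡⟨ cong (_+ lookup a i) (inflow-vertex (toℕ i) (toℕ<n i)) ⟨
      inflow G f (suc (toℕ i)) + lookup a i                 ∎)
    from : IsFlow G a f → Conserved 0 a c xs ys
    from flow = nth⇒Conserved 0 a c xs ys λ i → begin
      nth (blockSums ys) (toℕ i) + nth xs (toℕ i)           ≡⟨ outflow-vertex (toℕ i) ⟨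
      outflow G f (suc (toℕ i))                             ≡⟨ +m-+n≡+o⇒m≡n+o _ _ _ (tabulate⁻ flow i) ⟩
      inflow G f (suc (toℕ i)) + lookup a i                 ≡⟨ cong (_+ lookup a i) (inflow-vertex (toℕ i) (toℕ<n i)) ⟩
      nth (0 ∷ xs) (toℕ i) + lookup a i                     ∎

hasCount-flowCount : ∀ n (a c : Vec ℕ n) → HasCount (Pi n c) a (flowCount 0 a c)
hasCount-flowCount n a c = subst (λ G → HasCount G a (flowCount 0 a c)) (sym (Pi≡path++sinkEdges n c))
  (↔-trans (Fin-flowCount↔FlowData 0 a c)
           (Σ-↔ (rawFlow↔ 1 (suc n) c) (λ {(xs , ys)} → Conserved↔IsFlow a c xs ys)))

-- Leading terms

-- P s = V sᵈ + O(sᵈ⁻¹) for s ≥ 1, multiplied through by s to stay within ℕ.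
record LeadingTerm (d V : ℕ) (P : ℕ → ℕ) : Set where
  field
    K     : ℕ
    upper : ∀ t → let s = suc t in s * P s ≤ s * (V * s ^ d) + K * s ^ d
    lower : ∀ t → let s = suc t in s * (V * s ^ d) ≤ s * P s + K * s ^ d

open LeadingTerm

LeadingTerm-cong : ∀ {d V} {P Q : ℕ → ℕ} → (∀ s → P s ≡ Q s) → LeadingTerm d V P → LeadingTerm d V Q
LeadingTerm-cong P≗Q T = record
  { K     = K T
  ; upper = λ t → subst (λ z → suc t * z ≤ _) (P≗Q (suc t)) (upper T t)
  ; lower = λ t → subst (λ z → _ ≤ suc t * z + _) (P≗Q (suc t)) (lower T t)
  }

LeadingTerm-const : ∀ k → LeadingTerm 0 k (λ _ → k)
LeadingTerm-const k = record
  { K     = 0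
  ; upper = λ t → ≤-reflexive (upper-eq k (suc t))
  ; lower = λ t → ≤-reflexive (lower-eq k (suc t))
  }
  where
  upper-eq : ∀ k s → s * k ≡ s * (k * 1) + 0
  upper-eq = solve-∀
  lower-eq : ∀ k s → s * (k * 1) ≡ s * k + 0
  lower-eq = solve-∀

LeadingTerm-zero : ∀ d → LeadingTerm d 0 (λ _ → 0)
LeadingTerm-zero d = record
  { K     = 0
  ; upper = λ t → ≤-reflexive (sym (+-identityʳ _))
  ; lower = λ t → ≤-reflexive (sym (+-identityʳ _))
  }

LeadingTerm-linear : ∀ a c i → LeadingTerm 1 a (λ s → s * a + c ∸ i)
LeadingTerm-linear a c i = record { K = c + i ; upper = upper′ ∘ suc ; lower = lower′ ∘ suc }
  where
  open ≤-Reasoning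
  upper′ : ∀ s → s * (s * a + c ∸ i) ≤ s * (a * (s * 1)) + (c + i) * (s * 1)
  upper′ s = begin
    s * (s * a + c ∸ i)               ≤⟨ *-monoʳ-≤ s (m∸n≤m (s * a + c) i) ⟩
    s * (s * a + c)                   ≡⟨ eq a c s ⟩
    s * (a * (s * 1)) + c * (s * 1)   ≤⟨ +-monoʳ-≤ (s * (a * (s * 1))) (*-monoˡ-≤ (s * 1) (m≤m+n c i)) ⟩
    s * (a * (s * 1)) + (c + i) * (s * 1) ∎
    where
    eq : ∀ a c s → s * (s * a + c) ≡ s * (a * (s * 1)) + c * (s * 1)
    eq = solve-∀
  lower′ : ∀ s → s * (a * (s * 1)) ≤ s * (s * a + c ∸ i) + (c + i) * (s * 1)
  lower′ s = begin
    s * (a * (s * 1))                 ≡⟨ eq₁ a s ⟩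
    s * (s * a)                       ≤⟨ *-monoʳ-≤ s (≤-trans (m≤m+n (s * a) c) (m≤n+m∸n (s * a + c) i)) ⟩
    s * (i + (s * a + c ∸ i))         ≡⟨ eq₂ (s * a + c ∸ i) i s ⟩
    s * (s * a + c ∸ i) + i * (s * 1) ≤⟨ +-monoʳ-≤ (s * (s * a + c ∸ i)) (*-monoˡ-≤ (s * 1) (m≤n+m i c)) ⟩
    s * (s * a + c ∸ i) + (c + i) * (s * 1) ∎
    where
    eq₁ : ∀ a s → s * (a * (s * 1)) ≡ s * (s * a)
    eq₁ = solve-∀
    eq₂ : ∀ x i s → s * (i + x) ≡ s * x + i * (s * 1)
    eq₂ = solve-∀

LeadingTerm-+ : ∀ {d V W} {P Q : ℕ → ℕ} → LeadingTerm d V P → LeadingTerm d W Q →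
  LeadingTerm d (V + W) (λ s → P s + Q s)
LeadingTerm-+ {d} {V} {W} {P} {Q} T U = record { K = K T + K U ; upper = upper′ ; lower = lower′ }
  where
  open ≤-Reasoning
  upper′ : ∀ t → let s = suc t in s * (P s + Q s) ≤ s * ((V + W) * s ^ d) + (K T + K U) * s ^ d
  upper′ t = let s = suc t ; D = s ^ d in begin
    s * (P s + Q s)                                 ≡⟨ *-distribˡ-+ s (P s) (Q s) ⟩
    s * P s + s * Q s                               ≤⟨ +-mono-≤ (upper T t) (upper U t) ⟩
    (s * (V * D) + K T * D) + (s * (W * D) + K U * D) ≡⟨ eq s V W (K T) (K U) D ⟩
    s * ((V + W) * D) + (K T + K U) * D             ∎
    where
    eq : ∀ s V W K L D → (s * (V * D) + K * D) + (s * (W * D) + L * D) ≡ s * ((V + W) * D) + (K + L) * D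
    eq = solve-∀
  lower′ : ∀ t → let s = suc t in s * ((V + W) * s ^ d) ≤ s * (P s + Q s) + (K T + K U) * s ^ d
  lower′ t = let s = suc t ; D = s ^ d in begin
    s * ((V + W) * D)                               ≡⟨ eq₁ s V W D ⟩
    s * (V * D) + s * (W * D)                       ≤⟨ +-mono-≤ (lower T t) (lower U t) ⟩
    (s * P s + K T * D) + (s * Q s + K U * D)       ≡⟨ eq₂ s (P s) (Q s) (K T) (K U) D ⟩
    s * (P s + Q s) + (K T + K U) * D               ∎
    where
    eq₁ : ∀ s V W D → s * ((V + W) * D) ≡ s * (V * D) + s * (W * D)
    eq₁ = solve-∀
    eq₂ : ∀ s p q K L D → (s * p + K * D) + (s * q + L * D) ≡ s * (p + q) + (K + L) * D
    eq₂ = solve-∀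

module _ {d e V W} {P Q : ℕ → ℕ} (T : LeadingTerm d V P) (U : LeadingTerm e W Q) where
  private
    K₁ = K T
    K₂ = K U
    X  = V * K₂ + K₁ * W
    M  = X + 3 * (K₁ * K₂)
    absorb : ∀ s a x k F → s * (s * a + x * F) + s * (k * F) ≡ s * (s * a + (x + k) * F)
    absorb = solve-∀

  LeadingTerm-*-upper : ∀ t → let s = suc t in s * (P s * Q s) ≤ s * (V * W * s ^ (d + e)) + M * s ^ (d + e)
  LeadingTerm-*-upper t rewrite ^-distribˡ-+-* (suc t) d e = *-cancelˡ-≤ s (begin
    s * (s * (p * q))                                ≡⟨ eq₁ s p q ⟩
    (s * p) * (s * q)                                ≤⟨ *-mono-≤ (upper T t) (upper U t) ⟩
    (s * (V * D) + K₁ * D) * (s * (W * E) + K₂ * E)  ≡⟨ eq₂ s V W K₁ K₂ D E ⟩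
    s * (s * (V * W * F) + X * F) + K₁ * K₂ * F      ≤⟨ +-monoʳ-≤ _ (m≤n*m (K₁ * K₂ * F) s) ⟩
    s * (s * (V * W * F) + X * F) + s * (K₁ * K₂ * F) ≡⟨ absorb s (V * W * F) X (K₁ * K₂) F ⟩
    s * (s * (V * W * F) + (X + K₁ * K₂) * F)
      ≤⟨ *-monoʳ-≤ s (+-monoʳ-≤ _ (*-monoˡ-≤ F (+-monoʳ-≤ X (m≤n*m (K₁ * K₂) 3)))) ⟩
    s * (s * (V * W * F) + M * F)                    ∎)
    where
    open ≤-Reasoning
    s = suc t
    p = P s
    q = Q s
    D = s ^ d
    E = s ^ e
    F = D * E
    eq₁ : ∀ s p q → s * (s * (p * q)) ≡ (s * p) * (s * q)
    eq₁ = solve-∀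
    eq₂ : ∀ s V W K L D E → (s * (V * D) + K * D) * (s * (W * E) + L * E)
                          ≡ s * (s * (V * W * (D * E)) + (V * L + K * W) * (D * E)) + K * L * (D * E)
    eq₂ = solve-∀

  LeadingTerm-*-lower : ∀ t → let s = suc t in s * (V * W * s ^ (d + e)) ≤ s * (P s * Q s) + M * s ^ (d + e)
  LeadingTerm-*-lower t rewrite ^-distribˡ-+-* (suc t) d e = *-cancelˡ-≤ s (begin
    s * (s * (V * W * F))                                    ≡⟨ eq₁ s V W D E ⟩
    (s * (V * D)) * (s * (W * E))                            ≤⟨ *-mono-≤ (lower T t) (lower U t) ⟩
    (s * p + K₁ * D) * (s * q + K₂ * E)                      ≡⟨ eq₂ (s * p) (s * q) K₁ K₂ D E ⟩
    (s * p) * (s * q) + ((s * p) * (K₂ * E) + (K₁ * D) * (s * q)) + K₁ * K₂ * F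
      ≤⟨ +-monoˡ-≤ (K₁ * K₂ * F) (+-monoʳ-≤ ((s * p) * (s * q))
           (+-mono-≤ (*-monoˡ-≤ (K₂ * E) (upper T t)) (*-monoʳ-≤ (K₁ * D) (upper U t)))) ⟩
    (s * p) * (s * q) + ((s * (V * D) + K₁ * D) * (K₂ * E) + (K₁ * D) * (s * (W * E) + K₂ * E)) + K₁ * K₂ * F
      ≡⟨ eq₃ s p q V W K₁ K₂ D E ⟩
    s * (s * (p * q) + X * F) + 3 * (K₁ * K₂) * F           ≤⟨ +-monoʳ-≤ _ (m≤n*m (3 * (K₁ * K₂) * F) s) ⟩
    s * (s * (p * q) + X * F) + s * (3 * (K₁ * K₂) * F)     ≡⟨ absorb s (p * q) X (3 * (K₁ * K₂)) F ⟩
    s * (s * (p * q) + M * F)                                ∎)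
    where
    open ≤-Reasoning
    s = suc t
    p = P s
    q = Q s
    D = s ^ d
    E = s ^ e
    F = D * E
    eq₁ : ∀ s V W D E → s * (s * (V * W * (D * E))) ≡ (s * (V * D)) * (s * (W * E))
    eq₁ = solve-∀
    eq₂ : ∀ x y K L D E → (x + K * D) * (y + L * E) ≡ x * y + (x * (L * E) + (K * D) * y) + K * L * (D * E)
    eq₂ = solve-∀
    eq₃ : ∀ s p q V W K L D E →
      (s * p) * (s * q) + ((s * (V * D) + K * D) * (L * E) + (K * D) * (s * (W * E) + L * E)) + K * L * (D * E)
      ≡ s * (s * (p * q) + (V * L + K * W) * (D * E)) + 3 * (K * L) * (D * E)
    eq₃ = solve-∀

  LeadingTerm-* : LeadingTerm (d + e) (V * W) (λ s → P s * Q s)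
  LeadingTerm-* = record { K = M ; upper = LeadingTerm-*-upper ; lower = LeadingTerm-*-lower }

LeadingTerm-fallingFactorial : ∀ a c k → LeadingTerm k (a ^ k) (λ s → (s * a + c) P′ k)
LeadingTerm-fallingFactorial a c zero    = LeadingTerm-const 1
LeadingTerm-fallingFactorial a c (suc k) =
  LeadingTerm-* (LeadingTerm-linear a c k) (LeadingTerm-fallingFactorial a c k)

powerProduct : ∀ {n} → Vec ℕ n → Vec ℕ n → ℕ
powerProduct a j = Vec.foldr _ _*_ 1 (Vec.zipWith _^_ a j)

fallingProduct : ∀ {n} → ℕ → Vec ℕ n → Vec ℕ n → Vec ℕ n → ℕ
fallingProduct s []       []       []       = 1
fallingProduct s (a ∷ as) (c ∷ cs) (j ∷ js) = ((s * a + c) P′ j) * fallingProduct s as cs js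

LeadingTerm-fallingProduct : ∀ {n} (a c j : Vec ℕ n) →
  LeadingTerm (sum j) (powerProduct a j) (λ s → fallingProduct s a c j)
LeadingTerm-fallingProduct []       []       []       = LeadingTerm-const 1
LeadingTerm-fallingProduct (a ∷ as) (c ∷ cs) (j ∷ js) =
  LeadingTerm-* (LeadingTerm-fallingFactorial a c j) (LeadingTerm-fallingProduct as cs js)

factorialProduct : ∀ {n} → Vec ℕ n → ℕ
factorialProduct []       = 1
factorialProduct (j ∷ js) = j ! * factorialProduct js

k!*nCk≡nP′k : ∀ n k → k ! * (n C k) ≡ n P′ k
k!*nCk≡nP′k n k with k ≤? n
... | yes k≤n = begin
  k ! * (n C k)              ≡⟨ *-comm (k !) _ ⟩
  (n C k) * k !              ≡⟨ cong (_* k !) (nCk≡nPk/k! k≤n) ⟩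
  ((n P k) / k !) * k !      ≡⟨ cong (λ m → (m / k !) * k !) (nPk≡nP′k k≤n) ⟩
  ((n P′ k) / k !) * k !     ≡⟨ m/n*n≡m (k!∣nP′k k≤n) ⟩
  n P′ k                     ∎
  where
  open ≡-Reasoning
  instance _ = k !≢0
  nPk≡nP′k : ∀ {n k} → k ≤ n → n P k ≡ n P′ k
  nPk≡nP′k {n} {k} k≤n with k ≤ᵇ n | ≤⇒≤ᵇ k≤n
  ... | true | _ = refl
... | no k≰n = begin
  k ! * (n C k) ≡⟨ cong (k ! *_) (k>n⇒nCk≡0 (≰⇒> k≰n)) ⟩
  k ! * 0       ≡⟨ *-zeroʳ (k !) ⟩
  0             ≡⟨ nP′k≡0 n k (≰⇒> k≰n) ⟨
  n P′ k        ∎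
  where
  open ≡-Reasoning
  nP′k≡0 : ∀ n k → n < k → n P′ k ≡ 0
  nP′k≡0 n (suc k) (s≤s n≤k) = cong (_* (n P′ k)) (m≤n⇒m∸n≡0 n≤k)

fallingProduct≡factorialProduct*binomialProduct : ∀ {n} s (a c j : Vec ℕ n) →
  fallingProduct s a c j ≡ factorialProduct j * binomialProduct (Vec.map (s *_) a) c j
fallingProduct≡factorialProduct*binomialProduct s []       []       []       = refl
fallingProduct≡factorialProduct*binomialProduct s (a ∷ as) (c ∷ cs) (j ∷ js) = begin
  ((s * a + c) P′ j) * fallingProduct s as cs js
    ≡⟨ cong₂ _*_ (k!*nCk≡nP′k (s * a + c) j) (sym (fallingProduct≡factorialProduct*binomialProduct s as cs js)) ⟨
  (j ! * ((s * a + c) C j)) * (factorialProduct js * binomialProduct (Vec.map (s *_) as) cs js)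
    ≡⟨ *-*-exchange (j !) ((s * a + c) C j) (factorialProduct js) _ ⟩
  (j ! * factorialProduct js) * (((s * a + c) C j) * binomialProduct (Vec.map (s *_) as) cs js) ∎
  where
  open ≡-Reasoning
  *-*-exchange : ∀ w x y z → (w * x) * (y * z) ≡ (w * y) * (x * z)
  *-*-exchange = solve-∀

multinomial*factorialProduct : ∀ {n} (j : Vec ℕ n) → multinomial (toList j) * factorialProduct j ≡ (sum j) !
multinomial*factorialProduct []       = refl
multinomial*factorialProduct (x ∷ xs) = begin
  (((x + listSum (toList xs)) C x) * multinomial (toList xs)) * (x ! * factorialProduct xs)
    ≡⟨ cong (λ m → (((x + m) C x) * multinomial (toList xs)) * (x ! * factorialProduct xs)) (sum-toList xs) ⟩
  (((x + S) C x) * multinomial (toList xs)) * (x ! * factorialProduct xs)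
    ≡⟨ regroup ((x + S) C x) (multinomial (toList xs)) (x !) (factorialProduct xs) ⟩
  ((x + S) C x) * (x ! * (multinomial (toList xs) * factorialProduct xs))
    ≡⟨ cong (λ m → ((x + S) C x) * (x ! * m)) (multinomial*factorialProduct xs) ⟩
  ((x + S) C x) * (x ! * S !)
    ≡⟨ cong (λ m → ((x + S) C x) * (x ! * m !)) (m+n∸m≡n x S) ⟨
  ((x + S) C x) * (x ! * (x + S ∸ x) !)
    ≡⟨ cong (_* (x ! * (x + S ∸ x) !)) (nCk≡n!/k![n-k]! (m≤m+n x S)) ⟩
  ((x + S) ! / (x ! * (x + S ∸ x) !)) * (x ! * (x + S ∸ x) !)
    ≡⟨ m/n*n≡m (k![n∸k]!∣n! (m≤m+n x S)) ⟩
  (x + S) ! ∎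
  where
  open ≡-Reasoning
  S = sum xs
  instance _ = x !* (x + S ∸ x) !≢0
  sum-toList : ∀ {n} (v : Vec ℕ n) → listSum (toList v) ≡ sum v
  sum-toList []       = refl
  sum-toList (y ∷ ys) = cong (y +_) (sum-toList ys)
  regroup : ∀ a b c d → (a * b) * (c * d) ≡ a * (c * (b * d))
  regroup = solve-∀

volTerm : ∀ {n} → Vec ℕ n → Vec ℕ n → ℕ
volTerm a j = multinomial (toList j) * powerProduct a j

LeadingTerm-volTerm : ∀ {n} (a c j : Vec ℕ n) →
  LeadingTerm (sum j) (volTerm a j) (λ s → binomialProduct (Vec.map (s *_) a) c j * (sum j) !)
LeadingTerm-volTerm a c j = LeadingTerm-cong rearrange
  (LeadingTerm-* (LeadingTerm-const (multinomial (toList j))) (LeadingTerm-fallingProduct a c j))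
  where
  open ≡-Reasoning
  rearrange : ∀ s → multinomial (toList j) * fallingProduct s a c j ≡ binomialProduct (Vec.map (s *_) a) c j * (sum j) !
  rearrange s = begin
    multinomial (toList j) * fallingProduct s a c j
      ≡⟨ cong (multinomial (toList j) *_) (fallingProduct≡factorialProduct*binomialProduct s a c j) ⟩
    multinomial (toList j) * (factorialProduct j * binomialProduct (Vec.map (s *_) a) c j)
      ≡⟨ *-assoc (multinomial (toList j)) _ _ ⟨
    (multinomial (toList j) * factorialProduct j) * binomialProduct (Vec.map (s *_) a) c j
      ≡⟨ cong (_* binomialProduct (Vec.map (s *_) a) c j) (multinomial*factorialProduct j) ⟩
    (sum j) ! * binomialProduct (Vec.map (s *_) a) c j
      ≡⟨ *-comm ((sum j) !) _ ⟩
    binomialProduct (Vec.map (s *_) a) c j * (sum j) ! ∎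

LeadingTerm-∑∈ : ∀ {A : Set} {d} {V : A → ℕ} {P : A → ℕ → ℕ} (L : List A) →
  All (λ x → LeadingTerm d (V x) (P x)) L → LeadingTerm d (∑∈ L V) (λ s → ∑[ x ∈ L ] P x s)
LeadingTerm-∑∈ {d = d} []      []       = LeadingTerm-zero d
LeadingTerm-∑∈         (x ∷ L) (T ∷ Ts) = LeadingTerm-+ T (LeadingTerm-∑∈ L Ts)

All-sum-weakComps : ∀ n d → All (λ j → sum j ≡ d) (weakComps n d)
All-sum-weakComps zero    zero    = refl ∷ []
All-sum-weakComps zero    (suc d) = []
All-sum-weakComps (suc n) d       = concat⁺ (map⁺ (applyUpTo⁺₁ id (suc d) λ {k} k<1+d →
  map⁺ (All.map (λ sum-j≡d∸k → trans (cong (k +_) sum-j≡d∸k) (m+[n∸m]≡n (m<1+n⇒m≤n k<1+d)))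
                (All-sum-weakComps n (d ∸ k)))))

LeadingTerm-volRHS : ∀ {n} (a c : Vec ℕ n) →
  LeadingTerm (sum c) (volRHS a c) (λ s → countRHS₁ (Vec.map (s *_) a) c * (sum c) !)
LeadingTerm-volRHS {n} a c = LeadingTerm-cong (λ s → sym (*-distribʳ-∑∈ ((sum c) !) _ L))
  (LeadingTerm-∑∈ L (All.map (λ {j} sum-j≡sum-c → subst
    (λ d → LeadingTerm d (volTerm a j) (λ s → binomialProduct (Vec.map (s *_) a) c j * d !))
    sum-j≡sum-c (LeadingTerm-volTerm a c j)) (filter⁺ (dominates? c) (All-sum-weakComps n (sum c)))))
  where L = filter (dominates? c) (weakComps n (sum c))

-- Volume

toℚᵘ-fromℕ : ∀ n → toℚᵘ (fromℕ n) ≡ mkℚᵘ (ℤ.+ n) 0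
toℚᵘ-fromℕ n = cong toℚᵘ (ℚ.normalize-coprime (Coprime.sym (Coprime.1-coprimeTo n)))

∣⊖∣≡∣-∣ : ∀ m n → ℤ.∣ m ℤ.⊖ n ∣ ≡ ∣ m - n ∣
∣⊖∣≡∣-∣ m n with ≤-total n m
... | inj₁ n≤m = trans (cong ℤ.∣_∣ (ℤ.⊖-≥ n≤m)) (sym (m≤n⇒∣n-m∣≡n∸m n≤m))
... | inj₂ m≤n = trans (ℤ.∣⊖∣-≤ m≤n) (sym (m≤n⇒∣m-n∣≡n∸m m≤n))

toℚᵘ-fromℕ-product : ∀ V D → toℚᵘ (fromℕ V ℚ.* fromℕ D) ≃ mkℚᵘ (ℤ.+ (V * D)) 0
toℚᵘ-fromℕ-product V D = ℚᵘ.≃-trans (ℚ.toℚᵘ-homo-* (fromℕ V) (fromℕ D))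
  (ℚᵘ.≃-reflexive (trans (cong₂ ℚᵘ._*_ (toℚᵘ-fromℕ V) (toℚᵘ-fromℕ D))
                         (cong (λ z → mkℚᵘ z 0) (sym (ℤ.pos-* V D)))))

toℚᵘ-fromℕ-difference : ∀ X {y} B → toℚᵘ y ≃ mkℚᵘ (ℤ.+ B) 0 →
  toℚᵘ (fromℕ X ℚ.- y) ≃ mkℚᵘ (X ℤ.⊖ B) 0
toℚᵘ-fromℕ-difference X {y} B y≃B = ℚᵘ.≃-trans (ℚ.toℚᵘ-homo-+ (fromℕ X) (ℚ.- y))
  (ℚᵘ.≃-trans (ℚᵘ.+-congʳ (toℚᵘ (fromℕ X)) (ℚᵘ.≃-trans (ℚ.toℚᵘ-homo‿- y) (ℚᵘ.-‿cong y≃B)))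
  (ℚᵘ.≃-trans (ℚᵘ.≃-reflexive (cong (ℚᵘ._+ mkℚᵘ (ℤ.- ℤ.+ B) 0) (toℚᵘ-fromℕ X)))
  (ℚᵘ.*≡* (cong (ℤ._* ℤ.+ 1)
    (trans (cong₂ ℤ._+_ (ℤ.*-identityʳ (ℤ.+ X)) (ℤ.*-identityʳ (ℤ.- ℤ.+ B))) (ℤ.m-n≡m⊖n X B))))))

fromℕ-∣-∣<ε* : ∀ X V D p q .(cop : Coprime (suc p) (suc q)) →
  ∣ X - V * D ∣ * suc q < suc p * D →
  ℚ.∣ fromℕ X ℚ.- fromℕ V ℚ.* fromℕ D ∣ ℚ.< mkℚ +[1+ p ] q cop ℚ.* fromℕ D
fromℕ-∣-∣<ε* X V D p q cop lt =
  ℚ.toℚᵘ-cancel-< (ℚᵘ.<-respʳ-≃ (ℚᵘ.≃-sym rhs) (ℚᵘ.<-respˡ-≃ (ℚᵘ.≃-sym lhs) core))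
  where
  lhs : toℚᵘ ℚ.∣ fromℕ X ℚ.- fromℕ V ℚ.* fromℕ D ∣ ≃ mkℚᵘ (ℤ.+ ∣ X - V * D ∣) 0
  lhs = ℚᵘ.≃-trans (ℚ.toℚᵘ-homo-∣-∣ (fromℕ X ℚ.- fromℕ V ℚ.* fromℕ D))
    (ℚᵘ.≃-trans (ℚᵘ.∣-∣-cong (toℚᵘ-fromℕ-difference X (V * D) (toℚᵘ-fromℕ-product V D)))
                (ℚᵘ.≃-reflexive (cong (λ z → mkℚᵘ (ℤ.+ z) 0) (∣⊖∣≡∣-∣ X (V * D)))))
  rhs : toℚᵘ (mkℚ +[1+ p ] q cop ℚ.* fromℕ D) ≃ mkℚᵘ (+[1+ p ] ℤ.* ℤ.+ D) (q * 1)
  rhs = ℚᵘ.≃-trans (ℚ.toℚᵘ-homo-* (mkℚ +[1+ p ] q cop) (fromℕ D))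
                   (ℚᵘ.≃-reflexive (cong (mkℚᵘ +[1+ p ] q ℚᵘ.*_) (toℚᵘ-fromℕ D)))
  core : mkℚᵘ (ℤ.+ ∣ X - V * D ∣) 0 ℚᵘ.< mkℚᵘ (+[1+ p ] ℤ.* ℤ.+ D) (q * 1)
  core = ℚᵘ.*<* (subst₂ ℤ._<_
    (trans (cong (λ n → ℤ.+ (∣ X - V * D ∣ * suc n)) (sym (*-identityʳ q)))
           (ℤ.pos-* ∣ X - V * D ∣ (suc (q * 1))))
    (trans (ℤ.pos-* (suc p) D) (sym (ℤ.*-identityʳ (+[1+ p ] ℤ.* ℤ.+ D))))
    (ℤ.+<+ lt))

∣m-n∣≤k : ∀ {m n k} → m ≤ n + k → n ≤ m + k → ∣ m - n ∣ ≤ k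
∣m-n∣≤k {m} {n} m≤n+k n≤m+k with ∣m-n∣≡[m∸n]∨[n∸m] m n
... | inj₁ eq = subst (_≤ _) (sym eq) (m≤n+o⇒m∸n≤o m n m≤n+k)
... | inj₂ eq = subst (_≤ _) (sym eq) (m≤n+o⇒m∸n≤o n m n≤m+k)

HasCount-unique : ∀ G {n} (a : Vec ℕ n) {M N} → HasCount G a M → HasCount G a N → M ≡ N
HasCount-unique G a M-count N-count = ↔⇒≡ (↔-trans M-count (↔-sym N-count))

-- For ε = (p+1)/(q+1) the error K sᵈ⁻¹ drops below ε sᵈ as soon as s > K (q+1).
LeadingTerm⇒IsNormalizedVolume : ∀ G {n} (a : Vec ℕ n) d V (count : ℕ → ℕ) →
  (∀ s → HasCount G (Vec.map (s *_) a) (count s)) →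
  LeadingTerm d V (λ s → count s * d !) → IsNormalizedVolume G a d (fromℕ V)
LeadingTerm⇒IsNormalizedVolume G a d V count counts T (mkℚ (ℤ.+ zero)   _ _)   (ℚ.*<* (ℤ.+<+ ()))
LeadingTerm⇒IsNormalizedVolume G a d V count counts T (mkℚ -[1+ _ ]   _ _)   (ℚ.*<* ())
LeadingTerm⇒IsNormalizedVolume G a d V count counts T (mkℚ +[1+ p ] q cop) _ =
  K T * suc q , λ t K*[1+q]≤t N hasCount →
    fromℕ-∣-∣<ε* (N * d !) V (suc t ^ d) p q cop (error-bound t K*[1+q]≤t N hasCount)
  where
  open ≤-Reasoning
  error-bound : ∀ t → K T * suc q ≤ t → ∀ N → HasCount G (Vec.map (suc t *_) a) N →
    ∣ N * d ! - V * suc t ^ d ∣ * suc q < suc p * suc t ^ d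
  error-bound t K*[1+q]≤t N hasCount
    rewrite HasCount-unique G (Vec.map (suc t *_) a) hasCount (counts (suc t)) =
    *-cancelˡ-< s _ _ (begin-strict
      s * (E * suc q)           ≡⟨ *-assoc s E (suc q) ⟨
      (s * E) * suc q           ≤⟨ *-monoˡ-≤ (suc q) s*E≤K*D ⟩
      (K T * D) * suc q         ≡⟨ swap (K T) D (suc q) ⟩
      (K T * suc q) * D         <⟨ *-monoˡ-< D {{m^n≢0 s d}} (s≤s K*[1+q]≤t) ⟩
      s * D                     ≤⟨ *-monoʳ-≤ s (m≤m+n D (p * D)) ⟩
      s * (suc p * D)           ∎)
    where
    s = suc t
    D = s ^ d
    X = count s * d !
    E = ∣ X - V * D ∣
    s*E≤K*D : s * E ≤ K T * D
    s*E≤K*D = subst (_≤ K T * D) (sym (*-distribˡ-∣-∣ s X (V * D))) (∣m-n∣≤k (upper T t) (lower T t))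
    swap : ∀ x y z → (x * y) * z ≡ (x * z) * y
    swap = solve-∀

hasCount-countRHS₁ : ∀ n (a c : Vec ℕ (suc n)) → HasCount (Pi (suc n) c) a (countRHS₁ a c)
hasCount-countRHS₁ n a c =
  subst (HasCount (Pi (suc n) c) a) (sym (countRHS₁≡flowCount a c)) (hasCount-flowCount (suc n) a c)

corollary6p16 : (n : ℕ) (a c : Vec ℕ (suc n)) →
    IsNormalizedVolume (Pi (suc n) c) a (sum c) (fromℕ (volRHS a c))
    × HasCount (Pi (suc n) c) a (countRHS₁ a c)
    × countRHS₁ a c ≡ countRHS₂ a c
corollary6p16 n a c =
    LeadingTerm⇒IsNormalizedVolume (Pi (suc n) c) a (sum c) (volRHS a c) (λ s → countRHS₁ (Vec.map (s *_) a) c)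
      (λ s → hasCount-countRHS₁ n (Vec.map (s *_) a) c) (LeadingTerm-volRHS a c)
  , hasCount-countRHS₁ n a c
  , trans (countRHS₁≡flowCount a c) (sym (countRHS₂≡flowCount a c))
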